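{- Let $p,m,n$ be positive integers with $p\ge m\ge n\ge\frac p2$, and $C_1,C_2\in\mathbb{Q}$. With $U_k=C_1\big(H^{(1)}_{k+n}-H^{(1)}_{k+p-n-1}\big)+C_2\big(H^{(1)}_{k+m}-H^{(1)}_{k+p-m-1}\big)$ and $V_k=C_1\big(H^{(2)}_{k+n}-H^{(2)}_{k+p-n-1}\big)+C_2\big(H^{(2)}_{k+m}-H^{(2)}_{k+p-m-1}\big)$, \[ 0=\sum_{k=0}^{n}\binom{m+k}{k}\binom{m}{k}\binom{n+k}{k}\binom{n}{k}\Big[\big(1+k(H^{(1)}_{m+k}+H^{(1)}_{m-k}+H^{(1)}_{n+k}+H^{(1)}_{n-k}-4H^{(1)}_k)\big)U_k-k\,V_k\Big] + \sum_{k=n+1}^{m}(-1)^{k-n}\binom{m+k}{k}\binom{m}{k}\binom{n+k}{k}\Big/\binom{k-1}{n}\;U_k. \]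
   Context: Generalised harmonic sums: $H^{(i)}_n=\sum_{j=1}^n j^{ -i}$ for $n\ge1$ and $H^{(i)}_0=0$. -}

module Defs where

open import Data.Nat using (ℕ; zero; suc; _∸_) renaming (_+_ to _+ℕ_; _*_ to _*ℕ_)
open import Data.Nat.Combinatorics using (_C_)
open import Data.Integer using (+_)
open import Data.Rational using (ℚ; 0ℚ; 1ℚ; _+_; _*_; _-_; -_; _/_)

ι : ℕ → ℚ
ι n = (+ n) / 1

_^ℚ_ : ℚ → ℕ → ℚ
q ^ℚ zero = 1ℚ
q ^ℚ suc i = q * (q ^ℚ i)

H : ℕ → ℕ → ℚ
H i zero = 0ℚ
H i (suc j) = H i j + (((+ 1) / suc j) ^ℚ i)

-- division of a rational by a natural number; only ever used with a
-- nonzero divisor (the value at divisor 0 is an irrelevant junk value 0)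
_/ℕ_ : ℚ → ℕ → ℚ
q /ℕ zero = 0ℚ
q /ℕ suc d = q * ((+ 1) / suc d)

sumFrom : ℕ → ℕ → (ℕ → ℚ) → ℚ
sumFrom a zero f = 0ℚ
sumFrom a (suc l) f = f a + sumFrom (suc a) l f

-- ∑[ a , b ] f = Σ_{k=a}^{b} f k  (empty if b < a)
∑[_,_] : ℕ → ℕ → (ℕ → ℚ) → ℚ
∑[ a , b ] f = sumFrom a (suc b ∸ a) f

-- U_k and V_k from the statement (indices k+p-n-1 etc. are natural numbers
-- under the hypothesis m < p, so truncated subtraction is exact)
Uₖ : ℕ → ℕ → ℕ → ℚ → ℚ → ℕ → ℚ
Uₖ p m n C₁ C₂ k =
  C₁ * (H 1 (k +ℕ n) - H 1 (k +ℕ p ∸ n ∸ 1)) + C₂ * (H 1 (k +ℕ m) - H 1 (k +ℕ p ∸ m ∸ 1))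

Vₖ : ℕ → ℕ → ℕ → ℚ → ℚ → ℕ → ℚ
Vₖ p m n C₁ C₂ k =
  C₁ * (H 2 (k +ℕ n) - H 2 (k +ℕ p ∸ n ∸ 1)) + C₂ * (H 2 (k +ℕ m) - H 2 (k +ℕ p ∸ m ∸ 1))

RHS : ℕ → ℕ → ℕ → ℚ → ℚ → ℚ
RHS p m n C₁ C₂ =
  ∑[ 0 , n ] (λ k →
     ι (((m +ℕ k) C k) *ℕ (m C k) *ℕ ((n +ℕ k) C k) *ℕ (n C k))
     * ((1ℚ + ι k * (H 1 (m +ℕ k) + H 1 (m ∸ k) + H 1 (n +ℕ k) + H 1 (n ∸ k) - ι 4 * H 1 k))
          * Uₖ p m n C₁ C₂ k
        - ι k * Vₖ p m n C₁ C₂ k))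
  + ∑[ suc n , m ] (λ k →
     ((((- 1ℚ) ^ℚ (k ∸ n)) * ι (((m +ℕ k) C k) *ℕ (m C k) *ℕ ((n +ℕ k) C k))) /ℕ ((k ∸ 1) C n))
     * Uₖ p m n C₁ C₂ k)

{-# OPTIONS --safe #-}
-- With aₖ = (-1)ᵏ C(N+k,k) C(N,k), the rational function R_N(t) = Σₖ aₖ/(t+k) equals
-- t⁻¹ ∏_{j=1}^{N} (j-t)/(j+t), so it vanishes at t = 1, …, N. Expand t·R_m(t)·R_n(t) in
-- partial fractions: the coefficient of the pole at t = -j involves the regular part
-- Σ_{k≠j} aₖ/(k-j) of R_N there, which is aⱼ(2Hⱼ - H_{N+j} - H_{N-j}) for j ≤ N and R_N(-j)
-- for j > N. Evaluated at an integer 1 ≤ x ≤ m, where the product vanishes, the expansion is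
-- the claimed identity for U_k = 1/(k+x), V_k = 1/(k+x)². The U, V of the statement are
-- linear combinations of these, since H_{k+N} - H_{k+r} = Σ_{x=r+1}^{N} 1/(k+x) and
-- p-n-1 ≤ n, p-m-1 ≤ m.
module Submission where

open import Data.Empty using (⊥-elim)
import Data.Integer as ℤ
import Data.Integer.Properties as ℤ
import Data.Integer.Tactic.RingSolver as ℤ-Solver
open import Data.Nat using (ℕ; zero; suc; _∸_; _≤_; _<_; z≤n; s≤s; _!; ≢-nonZero⁻¹) renaming (_+_ to _+ℕ_; _*_ to _*ℕ_)
import Data.Nat.Properties as ℕ
open import Data.Nat.Properties using (_!≢0; _!*_!≢0)
open import Data.Nat.Combinatorics using (_C_; nCk≡n!/k![n-k]!; k![n∸k]!∣n!; k>n⇒nCk≡0; nCn≡1)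
open import Data.Nat.DivMod using (m/n*n≡m)
import Data.Nat.Tactic.RingSolver as ℕ-Solver
open import Data.Rational using (ℚ; 0ℚ; 1ℚ; _+_; _*_; _-_; -_; _/_; toℚᵘ; 1/_; ≢-nonZero)
open import Data.Rational.Properties using (_≟_; 1≢0; +-identityˡ; +-identityʳ; +-inverseʳ; +-assoc; +-comm; *-assoc; *-comm; *-identityˡ; *-identityʳ; *-zeroˡ; *-zeroʳ; *-distribˡ-+; neg-distribʳ-*; *-inverseʳ; +-*-ring; +-0-group; toℚᵘ-injective; toℚᵘ-fromℚᵘ; toℚᵘ-homo-+; toℚᵘ-homo-*)
open import Data.Rational.Solver using (module +-*-Solver)
import Data.Rational.Unnormalised as ℚᵘ
import Data.Rational.Unnormalised.Properties as ℚᵘ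
open import Data.Sum using (inj₁; inj₂)
open import Function.Base using (_∘_)
open import Relation.Binary.Definitions using (tri<; tri≈; tri>)
open import Relation.Binary.PropositionalEquality
open import Relation.Nullary.Decidable using (Dec; yes; no)
open import Defs

open import Algebra.Properties.Group +-0-group using (x∙y⁻¹≈ε⇒x≈y)
open import Algebra.Properties.Ring +-*-ring using (-1*x≈-x)

open +-*-Solver using (solve; _:+_; _:*_; _:-_; :-_; con; _:=_)
open ≡-Reasoning

private
  toℚᵘ-ι : ∀ n → toℚᵘ (ι n) ℚᵘ.≃ ℚᵘ.mkℚᵘ (ℤ.+ n) 0
  toℚᵘ-ι n = toℚᵘ-fromℚᵘ (ℚᵘ.mkℚᵘ (ℤ.+ n) 0)

ι-+ : ∀ a b → ι (a +ℕ b) ≡ ι a + ι b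
ι-+ a b = toℚᵘ-injective (ℚᵘ.≃-trans (toℚᵘ-ι (a +ℕ b)) (ℚᵘ.≃-sym (ℚᵘ.≃-trans (toℚᵘ-homo-+ (ι a) (ι b))
  (ℚᵘ.≃-trans (ℚᵘ.+-cong (toℚᵘ-ι a) (toℚᵘ-ι b)) (ℚᵘ.*≡* (trans (cross (ℤ.+ a) (ℤ.+ b)) (cong (ℤ._* ℤ.1ℤ) (sym (ℤ.pos-+ a b)))))))))
  where
  cross : ∀ x y → (x ℤ.* ℤ.1ℤ ℤ.+ y ℤ.* ℤ.1ℤ) ℤ.* ℤ.1ℤ ≡ (x ℤ.+ y) ℤ.* ℤ.1ℤ
  cross = ℤ-Solver.solve-∀

ι-* : ∀ a b → ι (a *ℕ b) ≡ ι a * ι b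
ι-* a b = toℚᵘ-injective (ℚᵘ.≃-trans (toℚᵘ-ι (a *ℕ b)) (ℚᵘ.≃-sym (ℚᵘ.≃-trans (toℚᵘ-homo-* (ι a) (ι b))
  (ℚᵘ.≃-trans (ℚᵘ.*-cong (toℚᵘ-ι a) (toℚᵘ-ι b)) (ℚᵘ.*≡* (cong (ℤ._* ℤ.1ℤ) (sym (ℤ.pos-* a b))))))))

ι-injective : ∀ {a b} → ι a ≡ ι b → a ≡ b
ι-injective {a} {b} eq with ℚᵘ.≃-trans (ℚᵘ.≃-sym (toℚᵘ-ι a)) (ℚᵘ.≃-trans (ℚᵘ.≃-reflexive (cong toℚᵘ eq)) (toℚᵘ-ι b))
... | ℚᵘ.*≡* e = ℤ.+-injective (trans (sym (ℤ.*-identityʳ (ℤ.+ a))) (trans e (ℤ.*-identityʳ (ℤ.+ b))))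

ι-∸ : ∀ {a b} → b ≤ a → ι (a ∸ b) ≡ ι a - ι b
ι-∸ {a} {b} b≤a = begin
  ι (a ∸ b)                 ≡⟨ solve 2 (λ x y → x := x :+ y :- y) refl (ι (a ∸ b)) (ι b) ⟩
  ι (a ∸ b) + ι b - ι b     ≡⟨ cong (_- ι b) (sym (ι-+ (a ∸ b) b)) ⟩
  ι (a ∸ b +ℕ b) - ι b      ≡⟨ cong (λ c → ι c - ι b) (ℕ.m∸n+n≡m b≤a) ⟩
  ι a - ι b                 ∎

ι-suc≢0 : ∀ n → ι (suc n) ≢ 0ℚ
ι-suc≢0 n e with ι-injective {suc n} {0} e
... | ()

ιa-ιb≢0 : ∀ {a b} → a ≢ b → ι a - ι b ≢ 0ℚ
ιa-ιb≢0 a≢b e = a≢b (ι-injective (x∙y⁻¹≈ε⇒x≈y _ _ e))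

inv : ℚ → ℚ
inv q with q ≟ 0ℚ
... | yes _ = 0ℚ
... | no q≢0 = (1/ q) {{≢-nonZero q≢0}}

inv-inverseʳ : ∀ {q} → q ≢ 0ℚ → q * inv q ≡ 1ℚ
inv-inverseʳ {q} q≢0 with q ≟ 0ℚ
... | yes q≡0 = ⊥-elim (q≢0 q≡0)
... | no q≢0′ = *-inverseʳ q {{≢-nonZero q≢0′}}

-- Field identities below are proved as ring identities modulo relations e ≡ 1
-- (typically e = x * inv x): the ring solver checks L ≡ R + K * (e - 1).
modulo₁ : ∀ {L R e} K → e ≡ 1ℚ → L ≡ R + K * (e - 1ℚ) → L ≡ R
modulo₁ {L} {R} K refl eq = trans eq (solve 2 (λ r k → r :+ k :* (con 1ℚ :- con 1ℚ) := r) refl R K)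

modulo₂ : ∀ {L R e₁ e₂} K₁ K₂ → e₁ ≡ 1ℚ → e₂ ≡ 1ℚ →
          L ≡ R + K₁ * (e₁ - 1ℚ) + K₂ * (e₂ - 1ℚ) → L ≡ R
modulo₂ K₁ K₂ e₁≡1 e₂≡1 eq = modulo₁ K₁ e₁≡1 (modulo₁ K₂ e₂≡1 eq)

modulo₃ : ∀ {L R e₁ e₂ e₃} K₁ K₂ K₃ → e₁ ≡ 1ℚ → e₂ ≡ 1ℚ → e₃ ≡ 1ℚ →
          L ≡ R + K₁ * (e₁ - 1ℚ) + K₂ * (e₂ - 1ℚ) + K₃ * (e₃ - 1ℚ) → L ≡ R
modulo₃ K₁ K₂ K₃ e₁≡1 e₂≡1 e₃≡1 eq = modulo₂ K₁ K₂ e₁≡1 e₂≡1 (modulo₁ K₃ e₃≡1 eq)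

inv-unique : ∀ a {b} → a * b ≡ 1ℚ → inv a ≡ b
inv-unique a {b} ab≡1 = modulo₂ b (- inv a) (inv-inverseʳ a≢0) ab≡1
  (solve 3 (λ i a b → i := b :+ b :* (a :* i :- con 1ℚ) :+ (:- i) :* (a :* b :- con 1ℚ)) refl (inv a) a b)
  where
  a≢0 : a ≢ 0ℚ
  a≢0 a≡0 = 1≢0 (trans (sym ab≡1) (trans (cong (_* b) a≡0) (*-zeroˡ b)))

inv-neg : ∀ q → inv (- q) ≡ - inv q
inv-neg q = by-cases (q ≟ 0ℚ)
  where
  by-cases : Dec (q ≡ 0ℚ) → inv (- q) ≡ - inv q
  by-cases (yes refl) = refl
  by-cases (no q≢0) = inv-unique (- q) (trans (solve 2 (λ a b → (:- a) :* (:- b) := a :* b) refl q (inv q)) (inv-inverseʳ q≢0))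

1/suc≡inv : ∀ n → ℤ.1ℤ / suc n ≡ inv (ι (suc n))
1/suc≡inv n = sym (inv-unique (ι (suc n)) (toℚᵘ-injective (ℚᵘ.≃-trans (toℚᵘ-homo-* (ι (suc n)) (ℤ.1ℤ / suc n))
  (ℚᵘ.≃-trans (ℚᵘ.*-cong (toℚᵘ-ι (suc n)) (toℚᵘ-fromℚᵘ (ℚᵘ.mkℚᵘ (ℤ.1ℤ) n))) (ℚᵘ.*≡* (cross (ℤ.+ suc n)))))))
  where
  cross : ∀ x → (x ℤ.* ℤ.1ℤ) ℤ.* ℤ.1ℤ ≡ ℤ.1ℤ ℤ.* (ℤ.1ℤ ℤ.* x)
  cross = ℤ-Solver.solve-∀

/ℕ≡*inv : ∀ q {c} → c ≢ 0 → q /ℕ c ≡ q * inv (ι c)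
/ℕ≡*inv q {zero} c≢0 = ⊥-elim (c≢0 refl)
/ℕ≡*inv q {suc c} _ = cong (q *_) (1/suc≡inv c)

x*d≡r⇒x≡r*i : ∀ {x d r i} → x * d ≡ r → d * i ≡ 1ℚ → x ≡ r * i
x*d≡r⇒x≡r*i {x} {d} {r} {i} x*d≡r d*i≡1 = begin
  x            ≡⟨ sym (*-identityʳ x) ⟩
  x * 1ℚ       ≡⟨ cong (x *_) (sym d*i≡1) ⟩
  x * (d * i)  ≡⟨ sym (*-assoc x d i) ⟩
  x * d * i    ≡⟨ cong (_* i) x*d≡r ⟩
  r * i        ∎

sum-cong : ∀ a l {f g : ℕ → ℚ} → (∀ k → a ≤ k → k < a +ℕ l → f k ≡ g k) →
           sumFrom a l f ≡ sumFrom a l g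
sum-cong a zero f≡g = refl
sum-cong a (suc l) f≡g = cong₂ _+_ (f≡g a ℕ.≤-refl (ℕ.m<m+n a (s≤s z≤n)))
  (sum-cong (suc a) l (λ k a<k k<a+1+l → f≡g k (ℕ.<⇒≤ a<k) (subst (k <_) (sym (ℕ.+-suc a l)) k<a+1+l)))

sum-ext : ∀ a l {f g : ℕ → ℚ} → (∀ k → f k ≡ g k) → sumFrom a l f ≡ sumFrom a l g
sum-ext a l f≡g = sum-cong a l (λ k _ _ → f≡g k)

sum-zero : ∀ a l {f : ℕ → ℚ} → (∀ k → a ≤ k → k < a +ℕ l → f k ≡ 0ℚ) → sumFrom a l f ≡ 0ℚ
sum-zero a l {f} f≡0 = trans (sum-cong a l {f} {λ _ → 0ℚ} f≡0) (zeros a l)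
  where
  zeros : ∀ a l → sumFrom a l (λ _ → 0ℚ) ≡ 0ℚ
  zeros a zero = refl
  zeros a (suc l) = cong (0ℚ +_) (zeros (suc a) l)

sum-+ : ∀ a l (f g : ℕ → ℚ) → sumFrom a l (λ k → f k + g k) ≡ sumFrom a l f + sumFrom a l g
sum-+ a zero f g = refl
sum-+ a (suc l) f g = trans (cong (f a + g a +_) (sum-+ (suc a) l f g))
  (solve 4 (λ x y z w → (x :+ y) :+ (z :+ w) := (x :+ z) :+ (y :+ w)) refl (f a) (g a) _ _)

sum-*ˡ : ∀ a l c (f : ℕ → ℚ) → sumFrom a l (λ k → c * f k) ≡ c * sumFrom a l f
sum-*ˡ a zero c f = sym (*-zeroʳ c)
sum-*ˡ a (suc l) c f = trans (cong (c * f a +_) (sum-*ˡ (suc a) l c f)) (sym (*-distribˡ-+ c (f a) _))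

sum-*ʳ : ∀ a l c (f : ℕ → ℚ) → sumFrom a l (λ k → f k * c) ≡ sumFrom a l f * c
sum-*ʳ a l c f = trans (sum-ext a l (λ k → *-comm (f k) c)) (trans (sum-*ˡ a l c f) (*-comm c _))

sum-neg : ∀ a l (f : ℕ → ℚ) → sumFrom a l (λ k → - f k) ≡ - sumFrom a l f
sum-neg a l f = trans (sum-ext a l (λ k → sym (-1*x≈-x (f k)))) (trans (sum-*ˡ a l (- 1ℚ) f) (-1*x≈-x _))

sum-- : ∀ a l (f g : ℕ → ℚ) → sumFrom a l (λ k → f k - g k) ≡ sumFrom a l f - sumFrom a l g
sum-- a l f g = trans (sum-+ a l f (λ k → - g k)) (cong (sumFrom a l f +_) (sum-neg a l g))

sum-split : ∀ a l₁ l₂ (f : ℕ → ℚ) → sumFrom a (l₁ +ℕ l₂) f ≡ sumFrom a l₁ f + sumFrom (a +ℕ l₁) l₂ f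
sum-split a zero l₂ f = trans (cong (λ b → sumFrom b l₂ f) (sym (ℕ.+-identityʳ a))) (sym (+-identityˡ _))
sum-split a (suc l₁) l₂ f = begin
  f a + sumFrom (suc a) (l₁ +ℕ l₂) f                             ≡⟨ cong (f a +_) (sum-split (suc a) l₁ l₂ f) ⟩
  f a + (sumFrom (suc a) l₁ f + sumFrom (suc a +ℕ l₁) l₂ f)       ≡⟨ sym (+-assoc (f a) _ _) ⟩
  f a + sumFrom (suc a) l₁ f + sumFrom (suc a +ℕ l₁) l₂ f         ≡⟨ cong (λ b → f a + sumFrom (suc a) l₁ f + sumFrom b l₂ f) (sym (ℕ.+-suc a l₁)) ⟩
  f a + sumFrom (suc a) l₁ f + sumFrom (a +ℕ suc l₁) l₂ f         ∎

sum-last : ∀ a l (f : ℕ → ℚ) → sumFrom a (suc l) f ≡ sumFrom a l f + f (a +ℕ l)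
sum-last a l f = begin
  sumFrom a (suc l) f                         ≡⟨ cong (λ n → sumFrom a n f) (ℕ.+-comm 1 l) ⟩
  sumFrom a (l +ℕ 1) f                        ≡⟨ sum-split a l 1 f ⟩
  sumFrom a l f + (f (a +ℕ l) + 0ℚ)           ≡⟨ cong (sumFrom a l f +_) (+-identityʳ _) ⟩
  sumFrom a l f + f (a +ℕ l)                  ∎

sum-shift : ∀ a l (f : ℕ → ℚ) → sumFrom (suc a) l f ≡ sumFrom a l (λ i → f (suc i))
sum-shift a zero f = refl
sum-shift a (suc l) f = cong (f (suc a) +_) (sum-shift (suc a) l f)

sum-truncate : ∀ n m (f : ℕ → ℚ) → n ≤ m → (∀ k → n < k → f k ≡ 0ℚ) →
               sumFrom 0 (suc m) f ≡ sumFrom 0 (suc n) f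
sum-truncate n m f n≤m f≡0 = begin
  sumFrom 0 (suc m) f                                     ≡⟨ cong (λ l → sumFrom 0 (suc l) f) (sym (ℕ.m+[n∸m]≡n n≤m)) ⟩
  sumFrom 0 (suc n +ℕ (m ∸ n)) f                          ≡⟨ sum-split 0 (suc n) (m ∸ n) f ⟩
  sumFrom 0 (suc n) f + sumFrom (suc n) (m ∸ n) f         ≡⟨ cong (sumFrom 0 (suc n) f +_) (sum-zero (suc n) (m ∸ n) (λ k n<k _ → f≡0 k n<k)) ⟩
  sumFrom 0 (suc n) f + 0ℚ                                ≡⟨ +-identityʳ _ ⟩
  sumFrom 0 (suc n) f                                     ∎

sum-swap : ∀ a l b r (F : ℕ → ℕ → ℚ) →
           sumFrom a l (λ j → sumFrom b r (F j)) ≡ sumFrom b r (λ k → sumFrom a l (λ j → F j k))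
sum-swap a zero b r F = sym (sum-zero b r (λ _ _ _ → refl))
sum-swap a (suc l) b r F = trans (cong (sumFrom b r (F a) +_) (sum-swap (suc a) l b r F))
  (sym (sum-+ b r (F a) (λ k → sumFrom (suc a) l (λ j → F j k))))

sum-*-sum : ∀ a l b r (f g : ℕ → ℚ) →
            sumFrom a l f * sumFrom b r g ≡ sumFrom a l (λ j → sumFrom b r (λ k → f j * g k))
sum-*-sum a l b r f g =
  trans (sym (sum-*ʳ a l (sumFrom b r g) f)) (sum-ext a l (λ j → sym (sum-*ˡ b r (f j) g)))

δ : ℕ → ℕ → ℚ
δ k j with k ℕ.≟ j
... | yes _ = 1ℚ
... | no _ = 0ℚ

δ-refl : ∀ j → δ j j ≡ 1ℚ
δ-refl j with j ℕ.≟ j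
... | yes _ = refl
... | no j≢j = ⊥-elim (j≢j refl)

δ-≢ : ∀ {k j} → k ≢ j → δ k j ≡ 0ℚ
δ-≢ {k} {j} k≢j with k ℕ.≟ j
... | yes k≡j = ⊥-elim (k≢j k≡j)
... | no _ = refl

sum-δ : ∀ a l j c → a ≤ j → j < a +ℕ l → sumFrom a l (λ k → δ k j * c) ≡ c
sum-δ a zero j c a≤j j<a+0 = ⊥-elim (ℕ.<-irrefl refl (ℕ.≤-trans j<a+0 (subst (_≤ j) (sym (ℕ.+-identityʳ a)) a≤j)))
sum-δ a (suc l) j c a≤j j<a+1+l = by-cases (a ℕ.≟ j)
  where
  by-cases : Dec (a ≡ j) → sumFrom a (suc l) (λ k → δ k j * c) ≡ c
  by-cases (yes refl) = begin
    δ a a * c + sumFrom (suc a) l (λ k → δ k a * c)   ≡⟨ cong₂ _+_ (trans (cong (_* c) (δ-refl a)) (*-identityˡ c))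
                                                           (sum-zero (suc a) l (λ k a<k _ → trans (cong (_* c) (δ-≢ (ℕ.>⇒≢ a<k))) (*-zeroˡ c))) ⟩
    c + 0ℚ                                            ≡⟨ +-identityʳ c ⟩
    c                                                 ∎
  by-cases (no a≢j) = begin
    δ a j * c + sumFrom (suc a) l (λ k → δ k j * c)   ≡⟨ cong₂ _+_ (trans (cong (_* c) (δ-≢ a≢j)) (*-zeroˡ c))
                                                           (sum-δ (suc a) l j c (ℕ.≤∧≢⇒< a≤j a≢j) (subst (j <_) (ℕ.+-suc a l) j<a+1+l)) ⟩
    0ℚ + c                                            ≡⟨ +-identityˡ c ⟩
    c                                                 ∎

nCk*[k!*[n∸k]!]≡n! : ∀ {n k} → k ≤ n → (n C k) *ℕ (k ! *ℕ (n ∸ k) !) ≡ n !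
nCk*[k!*[n∸k]!]≡n! {n} {k} k≤n = trans (cong (_*ℕ (k ! *ℕ (n ∸ k) !)) (nCk≡n!/k![n-k]! k≤n))
  (m/n*n≡m {{k !* (n ∸ k) !≢0}} (k![n∸k]!∣n! k≤n))

nCk≢0 : ∀ {n k} → k ≤ n → n C k ≢ 0
nCk≢0 {n} {k} k≤n nCk≡0 = ≢-nonZero⁻¹ (n !) {{n !≢0}}
  (trans (sym (nCk*[k!*[n∸k]!]≡n! k≤n)) (cong (_*ℕ (k ! *ℕ (n ∸ k) !)) nCk≡0))

nC[1+k]*[1+k]≡nCk*[n∸k] : ∀ n k → (n C suc k) *ℕ suc k ≡ (n C k) *ℕ (n ∸ k)
nC[1+k]*[1+k]≡nCk*[n∸k] n k with ℕ.<-cmp k n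
... | tri< k<n _ _ = ℕ.*-cancelʳ-≡ _ _ (k ! *ℕ (n ∸ suc k) !) {{k !* (n ∸ suc k) !≢0}} (begin
    (n C suc k) *ℕ suc k *ℕ (k ! *ℕ (n ∸ suc k) !)   ≡⟨ shuffle₁ (n C suc k) (suc k) (k !) _ ⟩
    (n C suc k) *ℕ (suc k ! *ℕ (n ∸ suc k) !)        ≡⟨ nCk*[k!*[n∸k]!]≡n! k<n ⟩
    n !                                              ≡⟨ sym (nCk*[k!*[n∸k]!]≡n! (ℕ.<⇒≤ k<n)) ⟩
    (n C k) *ℕ (k ! *ℕ (n ∸ k) !)                    ≡⟨ cong (λ m → (n C k) *ℕ (k ! *ℕ m !)) n∸k≡1+[n∸1+k] ⟩
    (n C k) *ℕ (k ! *ℕ (suc (n ∸ suc k)) !)          ≡⟨ cong (λ m → (n C k) *ℕ (k ! *ℕ (m *ℕ (n ∸ suc k) !))) (sym n∸k≡1+[n∸1+k]) ⟩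
    (n C k) *ℕ (k ! *ℕ ((n ∸ k) *ℕ (n ∸ suc k) !))   ≡⟨ shuffle₂ (n C k) (n ∸ k) (k !) _ ⟩
    (n C k) *ℕ (n ∸ k) *ℕ (k ! *ℕ (n ∸ suc k) !)     ∎)
  where
  shuffle₁ : ∀ a b c d → a *ℕ b *ℕ (c *ℕ d) ≡ a *ℕ (b *ℕ c *ℕ d)
  shuffle₁ = ℕ-Solver.solve-∀
  shuffle₂ : ∀ a b c d → a *ℕ (c *ℕ (b *ℕ d)) ≡ a *ℕ b *ℕ (c *ℕ d)
  shuffle₂ = ℕ-Solver.solve-∀
  n∸k≡1+[n∸1+k] : n ∸ k ≡ suc (n ∸ suc k)
  n∸k≡1+[n∸1+k] = ℕ.+-∸-assoc 1 k<n
... | tri≈ _ refl _ = begin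
    (k C suc k) *ℕ suc k   ≡⟨ cong (_*ℕ suc k) (k>n⇒nCk≡0 (ℕ.n<1+n k)) ⟩
    0                      ≡⟨ sym (ℕ.*-zeroʳ (k C k)) ⟩
    (k C k) *ℕ 0           ≡⟨ cong ((k C k) *ℕ_) (sym (ℕ.n∸n≡0 k)) ⟩
    (k C k) *ℕ (k ∸ k)     ∎
... | tri> _ _ n<k = trans (cong (_*ℕ suc k) (k>n⇒nCk≡0 (ℕ.<-trans n<k (ℕ.n<1+n k))))
  (sym (cong (_*ℕ (n ∸ k)) (k>n⇒nCk≡0 n<k)))

[1+n]Ck*[1+n∸k]≡[1+n]*nCk : ∀ n k → (suc n C k) *ℕ (suc n ∸ k) ≡ suc n *ℕ (n C k)
[1+n]Ck*[1+n∸k]≡[1+n]*nCk n k with ℕ.<-cmp k (suc n)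
... | tri< k<1+n _ _ = ℕ.*-cancelʳ-≡ _ _ (k ! *ℕ (n ∸ k) !) {{k !* (n ∸ k) !≢0}} (begin
    (suc n C k) *ℕ (suc n ∸ k) *ℕ (k ! *ℕ (n ∸ k) !)     ≡⟨ shuffle (suc n C k) (suc n ∸ k) (k !) _ ⟩
    (suc n C k) *ℕ (k ! *ℕ ((suc n ∸ k) *ℕ (n ∸ k) !))   ≡⟨ cong (λ m → (suc n C k) *ℕ (k ! *ℕ (m *ℕ (n ∸ k) !))) 1+n∸k≡1+[n∸k] ⟩
    (suc n C k) *ℕ (k ! *ℕ (suc (n ∸ k)) !)              ≡⟨ cong (λ m → (suc n C k) *ℕ (k ! *ℕ m !)) (sym 1+n∸k≡1+[n∸k]) ⟩
    (suc n C k) *ℕ (k ! *ℕ (suc n ∸ k) !)                ≡⟨ nCk*[k!*[n∸k]!]≡n! (ℕ.<⇒≤ k<1+n) ⟩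
    suc n *ℕ n !                                         ≡⟨ cong (suc n *ℕ_) (sym (nCk*[k!*[n∸k]!]≡n! k≤n)) ⟩
    suc n *ℕ ((n C k) *ℕ (k ! *ℕ (n ∸ k) !))             ≡⟨ sym (ℕ.*-assoc (suc n) (n C k) _) ⟩
    suc n *ℕ (n C k) *ℕ (k ! *ℕ (n ∸ k) !)               ∎)
  where
  shuffle : ∀ a b c d → a *ℕ b *ℕ (c *ℕ d) ≡ a *ℕ (c *ℕ (b *ℕ d))
  shuffle = ℕ-Solver.solve-∀
  k≤n : k ≤ n
  k≤n = ℕ.≤-pred k<1+n
  1+n∸k≡1+[n∸k] : suc n ∸ k ≡ suc (n ∸ k)
  1+n∸k≡1+[n∸k] = ℕ.+-∸-assoc 1 k≤n
... | tri≈ _ refl _ = trans (cong ((suc n C suc n) *ℕ_) (ℕ.n∸n≡0 n))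
  (trans (ℕ.*-zeroʳ (suc n C suc n)) (sym (trans (cong (suc n *ℕ_) (k>n⇒nCk≡0 (ℕ.n<1+n n))) (ℕ.*-zeroʳ (suc n)))))
... | tri> _ _ 1+n<k = trans (cong (_*ℕ (suc n ∸ k)) (k>n⇒nCk≡0 1+n<k))
  (sym (trans (cong (suc n *ℕ_) (k>n⇒nCk≡0 (ℕ.<-trans (ℕ.n<1+n n) 1+n<k))) (ℕ.*-zeroʳ (suc n))))

[a+1+b]Ca*[1+b]≡[a+1+b]*[a+b]Ca : ∀ a b → ((a +ℕ suc b) C a) *ℕ suc b ≡ (a +ℕ suc b) *ℕ ((a +ℕ b) C a)
[a+1+b]Ca*[1+b]≡[a+1+b]*[a+b]Ca a b = begin
  ((a +ℕ suc b) C a) *ℕ suc b              ≡⟨ cong (((a +ℕ suc b) C a) *ℕ_) (sym (ℕ.m+n∸m≡n a (suc b))) ⟩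
  ((a +ℕ suc b) C a) *ℕ (a +ℕ suc b ∸ a)   ≡⟨ subst (λ z → (z C a) *ℕ (z ∸ a) ≡ z *ℕ ((a +ℕ b) C a)) (sym (ℕ.+-suc a b))
                                                    ([1+n]Ck*[1+n∸k]≡[1+n]*nCk (a +ℕ b) a) ⟩
  (a +ℕ suc b) *ℕ ((a +ℕ b) C a)           ∎

H-suc : ∀ i n → H i (suc n) ≡ H i n + inv (ι (suc n)) ^ℚ i
H-suc i n = cong (λ x → H i n + x ^ℚ i) (1/suc≡inv n)

H₁-suc : ∀ n → H 1 (suc n) ≡ H 1 n + inv (ι (suc n))
H₁-suc n = trans (H-suc 1 n) (cong (H 1 n +_) (*-identityʳ _))

H-+ : ∀ i a l → H i (a +ℕ l) ≡ H i a + sumFrom 1 l (λ x → inv (ι (a +ℕ x)) ^ℚ i)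
H-+ i a zero = trans (cong (H i) (ℕ.+-identityʳ a)) (sym (+-identityʳ (H i a)))
H-+ i a (suc l) = begin
  H i (a +ℕ suc l)                        ≡⟨ cong (H i) (ℕ.+-suc a l) ⟩
  H i (suc (a +ℕ l))                      ≡⟨ H-suc i (a +ℕ l) ⟩
  H i (a +ℕ l) + inv (ι (suc (a +ℕ l))) ^ℚ i
                                          ≡⟨ cong (λ b → H i (a +ℕ l) + inv (ι b) ^ℚ i) (sym (ℕ.+-suc a l)) ⟩
  H i (a +ℕ l) + f (suc l)                ≡⟨ cong (_+ f (suc l)) (H-+ i a l) ⟩
  H i a + sumFrom 1 l f + f (suc l)       ≡⟨ +-assoc (H i a) _ _ ⟩
  H i a + (sumFrom 1 l f + f (1 +ℕ l))    ≡⟨ cong (H i a +_) (sym (sum-last 1 l f)) ⟩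
  H i a + sumFrom 1 (suc l) f             ∎
  where
  f : ℕ → ℚ
  f x = inv (ι (a +ℕ x)) ^ℚ i

H₁-reversed : ∀ J → sumFrom 0 (suc J) (λ i → inv (ι (suc J) - ι i)) ≡ H 1 (suc J)
H₁-reversed zero = refl
H₁-reversed (suc J) = begin
  inv (ι (2 +ℕ J) - 0ℚ) + sumFrom 1 (suc J) (λ i → inv (ι (2 +ℕ J) - ι i))
    ≡⟨ cong₂ _+_ (cong inv (+-identityʳ (ι (2 +ℕ J)))) (sum-shift 0 (suc J) (λ i → inv (ι (2 +ℕ J) - ι i))) ⟩
  inv (ι (2 +ℕ J)) + sumFrom 0 (suc J) (λ i → inv (ι (2 +ℕ J) - ι (suc i)))
    ≡⟨ cong (inv (ι (2 +ℕ J)) +_) (sum-ext 0 (suc J) (λ i → cong inv (trans (cong₂ _-_ (ι-+ 1 (suc J)) (ι-+ 1 i)) (shift-difference (ι (suc J)) (ι i))))) ⟩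
  inv (ι (2 +ℕ J)) + sumFrom 0 (suc J) (λ i → inv (ι (suc J) - ι i))
    ≡⟨ cong (inv (ι (2 +ℕ J)) +_) (H₁-reversed J) ⟩
  inv (ι (2 +ℕ J)) + H 1 (suc J)
    ≡⟨ trans (+-comm (inv (ι (2 +ℕ J))) (H 1 (suc J))) (sym (H₁-suc (suc J))) ⟩
  H 1 (2 +ℕ J)
    ∎
  where
  shift-difference : ∀ x y → ι 1 + x - (ι 1 + y) ≡ x - y
  shift-difference = solve 2 (λ x y → con (ι 1) :+ x :- (con (ι 1) :+ y) := x :- y) refl

sign : ℕ → ℚ
sign k = (- 1ℚ) ^ℚ k

sign-+ : ∀ a b → sign (a +ℕ b) ≡ sign a * sign b
sign-+ zero b = sym (*-identityˡ (sign b))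
sign-+ (suc a) b = trans (cong ((- 1ℚ) *_) (sign-+ a b)) (sym (*-assoc (- 1ℚ) (sign a) (sign b)))

sign*sign≡1 : ∀ n → sign n * sign n ≡ 1ℚ
sign*sign≡1 zero = refl
sign*sign≡1 (suc n) = trans (solve 1 (λ x → (:- con 1ℚ :* x) :* (:- con 1ℚ :* x) := x :* x) refl (sign n)) (sign*sign≡1 n)

-- The rational function R N t = Σₖ coeff N k / (t + k) in product form

magnitude : ℕ → ℕ → ℕ
magnitude N k = ((N +ℕ k) C k) *ℕ (N C k)

coeff : ℕ → ℕ → ℚ
coeff N k = sign k * ι (magnitude N k)

coeff-vanishes : ∀ {N k} → N < k → coeff N k ≡ 0ℚ
coeff-vanishes {N} {k} N<k = begin
  sign k * ι (((N +ℕ k) C k) *ℕ (N C k))   ≡⟨ cong (λ c → sign k * ι (((N +ℕ k) C k) *ℕ c)) (k>n⇒nCk≡0 N<k) ⟩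
  sign k * ι (((N +ℕ k) C k) *ℕ 0)         ≡⟨ cong (λ c → sign k * ι c) (ℕ.*-zeroʳ ((N +ℕ k) C k)) ⟩
  sign k * 0ℚ                              ≡⟨ *-zeroʳ (sign k) ⟩
  0ℚ                                       ∎

magnitude-suc : ∀ N k → magnitude (suc N) k *ℕ (suc N ∸ k) ≡ magnitude N k *ℕ (suc N +ℕ k)
magnitude-suc N k = ℕ.*-cancelʳ-≡ _ _ (suc N) (begin
  A′ *ℕ B′ *ℕ (suc N ∸ k) *ℕ suc N          ≡⟨ shuffle₁ A′ B′ (suc N ∸ k) (suc N) ⟩
  (A′ *ℕ suc N) *ℕ (B′ *ℕ (suc N ∸ k))      ≡⟨ cong₂ _*ℕ_ A′-absorb ([1+n]Ck*[1+n∸k]≡[1+n]*nCk N k) ⟩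
  (suc (N +ℕ k) *ℕ A) *ℕ (suc N *ℕ B)       ≡⟨ shuffle₂ (suc (N +ℕ k)) A (suc N) B ⟩
  A *ℕ B *ℕ suc (N +ℕ k) *ℕ suc N           ∎)
  where
  A = (N +ℕ k) C k
  B = N C k
  A′ = (suc N +ℕ k) C k
  B′ = suc N C k
  A′-absorb : A′ *ℕ suc N ≡ suc (N +ℕ k) *ℕ A
  A′-absorb = trans (cong (A′ *ℕ_) (sym (ℕ.m+n∸n≡m (suc N) k))) ([1+n]Ck*[1+n∸k]≡[1+n]*nCk (N +ℕ k) k)
  shuffle₁ : ∀ a b d s → a *ℕ b *ℕ d *ℕ s ≡ (a *ℕ s) *ℕ (b *ℕ d)
  shuffle₁ = ℕ-Solver.solve-∀
  shuffle₂ : ∀ e a s c → (e *ℕ a) *ℕ (s *ℕ c) ≡ a *ℕ c *ℕ e *ℕ s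
  shuffle₂ = ℕ-Solver.solve-∀

coeff-suc : ∀ {N k} → k ≤ N → coeff (suc N) k ≡ coeff N k * (ι (suc N) + ι k) * inv (ι (suc N) - ι k)
coeff-suc {N} {k} k≤N = x*d≡r⇒x≡r*i (begin
  coeff (suc N) k * (ι (suc N) - ι k)                    ≡⟨ cong (coeff (suc N) k *_) (sym (ι-∸ (ℕ.m≤n⇒m≤1+n k≤N))) ⟩
  sign k * ι (magnitude (suc N) k) * ι (suc N ∸ k)      ≡⟨ *-assoc (sign k) _ _ ⟩
  sign k * (ι (magnitude (suc N) k) * ι (suc N ∸ k))    ≡⟨ cong (sign k *_) (sym (ι-* (magnitude (suc N) k) (suc N ∸ k))) ⟩
  sign k * ι (magnitude (suc N) k *ℕ (suc N ∸ k))       ≡⟨ cong (λ c → sign k * ι c) (magnitude-suc N k) ⟩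
  sign k * ι (magnitude N k *ℕ (suc N +ℕ k))            ≡⟨ cong (sign k *_) (trans (ι-* (magnitude N k) (suc N +ℕ k)) (cong (ι (magnitude N k) *_) (ι-+ (suc N) k))) ⟩
  sign k * (ι (magnitude N k) * (ι (suc N) + ι k))      ≡⟨ sym (*-assoc (sign k) _ _) ⟩
  coeff N k * (ι (suc N) + ι k)                          ∎)
  (inv-inverseʳ (ιa-ιb≢0 (ℕ.>⇒≢ (s≤s k≤N))))

ι-[a+1+b]Ca : ∀ a b → ι ((a +ℕ suc b) C a) ≡ (ι a + ι (suc b)) * ι ((a +ℕ b) C a) * inv (ι (suc b))
ι-[a+1+b]Ca a b = x*d≡r⇒x≡r*i {d = ι (suc b)}
  (trans (sym (ι-* ((a +ℕ suc b) C a) (suc b))) (trans (cong ι ([a+1+b]Ca*[1+b]≡[a+1+b]*[a+b]Ca a b))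
    (trans (ι-* (a +ℕ suc b) ((a +ℕ b) C a)) (cong (_* ι ((a +ℕ b) C a)) (ι-+ a (suc b))))))
  (inv-inverseʳ (ι-suc≢0 b))

inv-ι-nC[1+k] : ∀ {n k} → k < n → inv (ι (n C suc k)) ≡ ι (suc k) * inv (ι (n C k)) * inv (ι (suc n) - ι (suc k))
inv-ι-nC[1+k] {n} {k} k<n = inv-unique B′ (modulo₂ (d * inv d) 1ℚ
  (inv-inverseʳ (λ B≡0 → nCk≢0 (ℕ.<⇒≤ k<n) (ι-injective B≡0)))
  (inv-inverseʳ (ιa-ιb≢0 (ℕ.>⇒≢ (s≤s k<n))))
  (begin
    B′ * (s * inv B * inv d)          ≡⟨ solve 4 (λ b s ib id → b :* (s :* ib :* id) := b :* s :* ib :* id) refl B′ s (inv B) (inv d) ⟩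
    B′ * s * inv B * inv d            ≡⟨ cong (λ x → x * inv B * inv d) B′*s≡B*d ⟩
    B * d * inv B * inv d             ≡⟨ solve 4 (λ b d ib id → b :* d :* ib :* id
                                                  := con 1ℚ :+ (d :* id) :* (b :* ib :- con 1ℚ) :+ con 1ℚ :* (d :* id :- con 1ℚ)) refl
                                           B d (inv B) (inv d) ⟩
    1ℚ + d * inv d * (B * inv B - 1ℚ) + 1ℚ * (d * inv d - 1ℚ)   ∎))
  where
  s = ι (suc k)
  d = ι (suc n) - ι (suc k)
  B = ι (n C k)
  B′ = ι (n C suc k)
  B′*s≡B*d : B′ * s ≡ B * d
  B′*s≡B*d = trans (sym (ι-* (n C suc k) (suc k))) (trans (cong ι (nC[1+k]*[1+k]≡nCk*[n∸k] n k))
    (trans (ι-* (n C k) (n ∸ k)) (cong (B *_) (ι-∸ {suc n} {suc k} (ℕ.m≤n⇒m≤1+n k<n)))))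

R : ℕ → ℚ → ℚ
R N t = sumFrom 0 (suc N) (λ k → coeff N k * inv (t + ι k))

Π : ℕ → ℚ → ℚ
Π zero t = inv t
Π (suc N) t = Π N t * ((ι (suc N) - t) * inv (t + ι (suc N)))

NonPole : ℕ → ℚ → Set
NonPole N t = ∀ i → i ≤ N → t + ι i ≢ 0ℚ

NonPole-neg : ∀ N J → N < J → NonPole N (- ι J)
NonPole-neg N J N<J i i≤N -J+i≡0 = ℕ.<-irrefl (ι-injective J≡i) (ℕ.≤-<-trans i≤N N<J)
  where
  J≡i : ι i ≡ ι J
  J≡i = trans (solve 2 (λ x y → y := (:- x :+ y) :+ x) refl (ι J) (ι i)) (trans (cong (_+ ι J) -J+i≡0) (+-identityˡ (ι J)))

NonPole-pos : ∀ N x → NonPole N (ι (suc x))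
NonPole-pos N x i _ e with ι-injective {suc x +ℕ i} {0} (trans (ι-+ (suc x) i) e)
... | ()

Π-zero : ∀ N x → 1 ≤ x → x ≤ N → Π N (ι x) ≡ 0ℚ
Π-zero zero x 1≤x x≤0 = ⊥-elim (ℕ.<-irrefl refl (ℕ.≤-trans 1≤x x≤0))
Π-zero (suc N) x 1≤x x≤1+N with ℕ.m≤n⇒m<n∨m≡n x≤1+N
... | inj₁ (s≤s x≤N) = trans (cong (_* factor) (Π-zero N x 1≤x x≤N)) (*-zeroˡ factor)
  where
  factor = (ι (suc N) - ι x) * inv (ι x + ι (suc N))
... | inj₂ refl = begin
  Π N (ι x) * ((ι x - ι x) * inv (ι x + ι x))   ≡⟨ cong (λ d → Π N (ι x) * (d * inv (ι x + ι x))) (+-inverseʳ (ι x)) ⟩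
  Π N (ι x) * (0ℚ * inv (ι x + ι x))            ≡⟨ cong (Π N (ι x) *_) (*-zeroˡ (inv (ι x + ι x))) ⟩
  Π N (ι x) * 0ℚ                                ≡⟨ *-zeroʳ (Π N (ι x)) ⟩
  0ℚ                                            ∎

Π-neg : ∀ N J → N < J → Π N (- ι J) ≡ (- sign N) * ι ((J +ℕ N) C J) * inv (ι J) * inv (ι ((J ∸ 1) C N))
Π-neg zero (suc J) _ = begin
  inv (- ι (suc J))                                  ≡⟨ inv-neg (ι (suc J)) ⟩
  - inv (ι (suc J))                                  ≡⟨ solve 1 (λ x → :- x := :- con 1ℚ :* con 1ℚ :* x :* con 1ℚ) refl (inv (ι (suc J))) ⟩
  - 1ℚ * 1ℚ * inv (ι (suc J)) * 1ℚ                   ≡⟨ cong (λ c → - 1ℚ * ι c * inv (ι (suc J)) * 1ℚ) (sym (trans (cong (_C suc J) (ℕ.+-identityʳ (suc J))) (nCn≡1 (suc J)))) ⟩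
  - 1ℚ * ι ((suc J +ℕ 0) C suc J) * inv (ι (suc J)) * 1ℚ   ∎
Π-neg (suc N) (suc J) (s≤s N<J) = begin
  Π N (- j) * ((s - (- j)) * inv (- j + s))
    ≡⟨ cong₂ (λ a b → a * ((s - (- j)) * b)) (Π-neg N (suc J) (ℕ.m<n⇒m<1+n N<J))
             (trans (cong inv (solve 2 (λ j s → :- j :+ s := :- (j :- s)) refl j s)) (inv-neg (j - s))) ⟩
  (- σ) * A * inv j * inv B * ((s - (- j)) * (- inv (j - s)))
    ≡⟨ modulo₁ ((- σ) * (j + s) * A * inv j * inv B * inv (j - s)) (inv-inverseʳ (ι-suc≢0 N))
         (solve 8 (λ σ A j s ij iB id is → (:- σ) :* A :* ij :* iB :* ((s :- (:- j)) :* (:- id))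
                   := (:- (:- con 1ℚ :* σ)) :* ((j :+ s) :* A :* is) :* ij :* (s :* iB :* id)
                      :+ ((:- σ) :* (j :+ s) :* A :* ij :* iB :* id) :* (s :* is :- con 1ℚ)) refl
                σ A j s (inv j) (inv B) (inv (j - s)) (inv s)) ⟩
  (- (- 1ℚ * σ)) * ((j + s) * A * inv s) * inv j * (s * inv B * inv (j - s))
    ≡⟨ cong₂ (λ a b → (- (- 1ℚ * σ)) * a * inv j * b) (sym (ι-[a+1+b]Ca (suc J) N)) (sym (inv-ι-nC[1+k] N<J)) ⟩
  (- sign (suc N)) * ι ((suc J +ℕ suc N) C suc J) * inv j * inv (ι (J C suc N))
    ∎
  where
  j = ι (suc J)
  s = ι (suc N)
  σ = sign N
  A = ι ((suc J +ℕ N) C suc J)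
  B = ι (J C N)

-- With u = 1/(t+k), v = 1/(c-k), w = 1/(t+c):
-- (c+k)/((c-k)(t+k)) = (c-t)/((t+c)(t+k)) + 2c/((t+c)(c-k)), and its analogue for (t+k)².
partial-fractions₁ : ∀ t c k u v w → (t + k) * u ≡ 1ℚ → (c - k) * v ≡ 1ℚ → (t + c) * w ≡ 1ℚ →
                     (c + k) * v * u ≡ (c - t) * w * u + (c + c) * w * v
partial-fractions₁ t c k u v w u-inv v-inv w-inv =
  modulo₃ ((c + k) * w * v + w) ((c + k) * w * u - w) (- ((c + k) * v * u)) u-inv v-inv w-inv
    (solve 6 (λ t c k u v w → (c :+ k) :* v :* u
                := (c :- t) :* w :* u :+ (c :+ c) :* w :* v
                   :+ ((c :+ k) :* w :* v :+ w) :* ((t :+ k) :* u :- con 1ℚ)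
                   :+ ((c :+ k) :* w :* u :- w) :* ((c :- k) :* v :- con 1ℚ)
                   :+ (:- ((c :+ k) :* v :* u)) :* ((t :+ c) :* w :- con 1ℚ)) refl t c k u v w)

partial-fractions₂ : ∀ t c k u v w → (t + k) * u ≡ 1ℚ → (c - k) * v ≡ 1ℚ → (t + c) * w ≡ 1ℚ →
                     (c + k) * v * (u * u) ≡ (- 1ℚ + (c + c) * w) * (u * u) + (c + c) * (w * w) * u + (c + c) * (w * w) * v
partial-fractions₂ t c k u v w u-inv v-inv w-inv =
  modulo₃ (u * ((c + k) * w * v + w) + (c + c) * w * w * v) (u * ((c + k) * w * u - w) + (c + c) * w * w * u)
          (u * (- ((c + k) * v * u)) - (c + c) * w * v * u - u * u) u-inv v-inv w-inv
    (solve 6 (λ t c k u v w → (c :+ k) :* v :* (u :* u)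
                := (:- con 1ℚ :+ (c :+ c) :* w) :* (u :* u) :+ (c :+ c) :* (w :* w) :* u :+ (c :+ c) :* (w :* w) :* v
                   :+ (u :* ((c :+ k) :* w :* v :+ w) :+ (c :+ c) :* w :* w :* v) :* ((t :+ k) :* u :- con 1ℚ)
                   :+ (u :* ((c :+ k) :* w :* u :- w) :+ (c :+ c) :* w :* w :* u) :* ((c :- k) :* v :- con 1ℚ)
                   :+ (u :* (:- ((c :+ k) :* v :* u)) :- (c :+ c) :* w :* v :* u :- u :* u) :* ((t :+ c) :* w :- con 1ℚ)) refl
             t c k u v w)

coeff-diagonal : ∀ N → coeff (suc N) (suc N) ≡ (ι (suc N) + ι (suc N)) * Π N (- ι (suc N))
coeff-diagonal N = begin
  sign (suc N) * ι (((suc N +ℕ suc N) C suc N) *ℕ (suc N C suc N))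
    ≡⟨ cong (λ x → sign (suc N) * ι (((suc N +ℕ suc N) C suc N) *ℕ x)) (nCn≡1 (suc N)) ⟩
  sign (suc N) * ι (((suc N +ℕ suc N) C suc N) *ℕ 1)
    ≡⟨ cong (λ x → sign (suc N) * ι x) (ℕ.*-identityʳ ((suc N +ℕ suc N) C suc N)) ⟩
  - 1ℚ * σ * ι ((suc N +ℕ suc N) C suc N)
    ≡⟨ cong (- 1ℚ * σ *_) (ι-[a+1+b]Ca (suc N) N) ⟩
  - 1ℚ * σ * ((c + c) * G * inv c)
    ≡⟨ solve 4 (λ σ c G ic → :- con 1ℚ :* σ :* ((c :+ c) :* G :* ic) := (c :+ c) :* ((:- σ) :* G :* ic :* con 1ℚ)) refl σ c G (inv c) ⟩
  (c + c) * ((- σ) * G * inv c * inv (ι 1))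
    ≡⟨ cong (λ x → (c + c) * ((- σ) * G * inv c * inv (ι x))) (sym (nCn≡1 N)) ⟩
  (c + c) * ((- σ) * G * inv c * inv (ι (N C N)))
    ≡⟨ cong ((c + c) *_) (sym (Π-neg N (suc N) ℕ.≤-refl)) ⟩
  (c + c) * Π N (- c)
    ∎
  where
  c = ι (suc N)
  σ = sign N
  G = ι ((suc N +ℕ N) C suc N)

sum-coeff/[1+N-k] : ∀ N → sumFrom 0 (suc N) (λ k → coeff N k * inv (ι (suc N) - ι k)) ≡ - R N (- ι (suc N))
sum-coeff/[1+N-k] N = trans (sum-ext 0 (suc N) term) (sum-neg 0 (suc N) (λ k → coeff N k * inv (- c + ι k)))
  where
  c = ι (suc N)
  term : ∀ k → coeff N k * inv (c - ι k) ≡ - (coeff N k * inv (- c + ι k))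
  term k = begin
    coeff N k * inv (c - ι k)            ≡⟨ cong (λ x → coeff N k * inv x) (solve 2 (λ c k → c :- k := :- (:- c :+ k)) refl c (ι k)) ⟩
    coeff N k * inv (- (- c + ι k))      ≡⟨ cong (coeff N k *_) (inv-neg (- c + ι k)) ⟩
    coeff N k * - inv (- c + ι k)        ≡⟨ sym (neg-distribʳ-* (coeff N k) _) ⟩
    - (coeff N k * inv (- c + ι k))      ∎

R-term-suc : ∀ {N} t k → k ≤ N → t + ι k ≢ 0ℚ → t + ι (suc N) ≢ 0ℚ →
  let c = ι (suc N)
      w = inv (t + c)
  in coeff (suc N) k * inv (t + ι k) ≡ (c - t) * w * (coeff N k * inv (t + ι k)) + (c + c) * w * (coeff N k * inv (c - ι k))
R-term-suc {N} t k k≤N t+k≢0 t+c≢0 = begin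
  coeff (suc N) k * inv (t + ι k)
    ≡⟨ cong (_* inv (t + ι k)) (coeff-suc k≤N) ⟩
  coeff N k * (c + ι k) * inv (c - ι k) * inv (t + ι k)
    ≡⟨ solve 4 (λ a b v u → a :* b :* v :* u := a :* (b :* v :* u)) refl (coeff N k) (c + ι k) (inv (c - ι k)) (inv (t + ι k)) ⟩
  coeff N k * ((c + ι k) * inv (c - ι k) * inv (t + ι k))
    ≡⟨ cong (coeff N k *_) (partial-fractions₁ t c (ι k) (inv (t + ι k)) (inv (c - ι k)) w
         (inv-inverseʳ t+k≢0) (inv-inverseʳ (ιa-ιb≢0 (ℕ.>⇒≢ (s≤s k≤N)))) (inv-inverseʳ t+c≢0)) ⟩
  coeff N k * ((c - t) * w * inv (t + ι k) + (c + c) * w * inv (c - ι k))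
    ≡⟨ solve 5 (λ a α u β v → a :* (α :* u :+ β :* v) := α :* (a :* u) :+ β :* (a :* v)) refl
         (coeff N k) ((c - t) * w) (inv (t + ι k)) ((c + c) * w) (inv (c - ι k)) ⟩
  (c - t) * w * (coeff N k * inv (t + ι k)) + (c + c) * w * (coeff N k * inv (c - ι k))
    ∎
  where
  c = ι (suc N)
  w = inv (t + c)

R≡Π : ∀ N t → NonPole N t → R N t ≡ Π N t
R≡Π zero t _ = trans (+-identityʳ _) (trans (*-identityˡ _) (cong inv (+-identityʳ t)))
R≡Π (suc N) t t-regular = begin
  R (suc N) t
    ≡⟨ sum-last 0 (suc N) f ⟩
  sumFrom 0 (suc N) f + f (suc N)
    ≡⟨ cong (_+ f (suc N)) (sum-cong 0 (suc N) (λ k _ k<1+N →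
         R-term-suc t k (ℕ.≤-pred k<1+N) (t-regular k (ℕ.<⇒≤ k<1+N)) (t-regular (suc N) ℕ.≤-refl))) ⟩
  sumFrom 0 (suc N) (λ k → α * X k + β * Y k) + f (suc N)
    ≡⟨ cong (_+ f (suc N)) (trans (sum-+ 0 (suc N) (λ k → α * X k) (λ k → β * Y k))
                                  (cong₂ _+_ (sum-*ˡ 0 (suc N) α X) (sum-*ˡ 0 (suc N) β Y))) ⟩
  α * R N t + β * sumFrom 0 (suc N) Y + f (suc N)
    ≡⟨ cong₂ (λ x y → α * x + β * y + f (suc N)) (R≡Π N t (λ i i≤N → t-regular i (ℕ.m≤n⇒m≤1+n i≤N)))
         (trans (sum-coeff/[1+N-k] N) (cong -_ (R≡Π N (- c) (NonPole-neg N (suc N) ℕ.≤-refl)))) ⟩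
  α * Π N t + β * (- Π N (- c)) + coeff (suc N) (suc N) * w
    ≡⟨ cong (λ x → α * Π N t + β * (- Π N (- c)) + x * w) (coeff-diagonal N) ⟩
  α * Π N t + β * (- Π N (- c)) + (c + c) * Π N (- c) * w
    ≡⟨ solve 5 (λ p q c t w → (c :- t) :* w :* p :+ (c :+ c) :* w :* (:- q) :+ (c :+ c) :* q :* w
                            := p :* ((c :- t) :* w)) refl (Π N t) (Π N (- c)) c t w ⟩
  Π (suc N) t
    ∎
  where
  c = ι (suc N)
  w = inv (t + c)
  α = (c - t) * w
  β = (c + c) * w
  f X Y : ℕ → ℚ
  f k = coeff (suc N) k * inv (t + ι k)
  X k = coeff N k * inv (t + ι k)
  Y k = coeff N k * inv (c - ι k)

-- Regular parts of R at its poles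

-- R₂ = - ∂ₜR and Q = - ∂ₜ log Π, so that R₂ = Π Q.
R₂ : ℕ → ℚ → ℚ
R₂ N t = sumFrom 0 (suc N) (λ k → coeff N k * (inv (t + ι k) * inv (t + ι k)))

Q : ℕ → ℚ → ℚ
Q N t = sumFrom 0 (suc N) (λ i → inv (t + ι i)) - sumFrom 1 N (λ i → inv (t - ι i))

Q-suc : ∀ N t → Q (suc N) t ≡ Q N t + inv (t + ι (suc N)) - inv (t - ι (suc N))
Q-suc N t = trans (cong₂ _-_ (sum-last 0 (suc N) (λ i → inv (t + ι i))) (sum-last 1 N (λ i → inv (t - ι i))))
  (solve 4 (λ a b c d → (a :+ b) :- (c :+ d) := a :- c :+ b :- d) refl (sumFrom 0 (suc N) (λ i → inv (t + ι i))) (inv (t + ι (suc N)))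
                 (sumFrom 1 N (λ i → inv (t - ι i))) (inv (t - ι (suc N))))

R₂-term-suc : ∀ {N} t k → k ≤ N → t + ι k ≢ 0ℚ → t + ι (suc N) ≢ 0ℚ →
  let c = ι (suc N)
      w = inv (t + c)
      u = inv (t + ι k)
  in coeff (suc N) k * (u * u)
     ≡ (- 1ℚ + (c + c) * w) * (coeff N k * (u * u)) + (c + c) * (w * w) * (coeff N k * u) + (c + c) * (w * w) * (coeff N k * inv (c - ι k))
R₂-term-suc {N} t k k≤N t+k≢0 t+c≢0 = begin
  coeff (suc N) k * (u * u)                       ≡⟨ cong (_* (u * u)) (coeff-suc k≤N) ⟩
  coeff N k * (c + ι k) * v * (u * u)             ≡⟨ solve 4 (λ a b v q → a :* b :* v :* q := a :* (b :* v :* q)) refl (coeff N k) (c + ι k) v (u * u) ⟩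
  coeff N k * ((c + ι k) * v * (u * u))
    ≡⟨ cong (coeff N k *_) (partial-fractions₂ t c (ι k) u v w (inv-inverseʳ t+k≢0)
                              (inv-inverseʳ (ιa-ιb≢0 (ℕ.>⇒≢ (s≤s k≤N)))) (inv-inverseʳ t+c≢0)) ⟩
  coeff N k * (α * (u * u) + β * u + β * v)
    ≡⟨ solve 5 (λ a α β u v → a :* (α :* (u :* u) :+ β :* u :+ β :* v) := α :* (a :* (u :* u)) :+ β :* (a :* u) :+ β :* (a :* v)) refl
         (coeff N k) α β u v ⟩
  α * (coeff N k * (u * u)) + β * (coeff N k * u) + β * (coeff N k * v)   ∎
  where
  c = ι (suc N)
  w = inv (t + c)
  u = inv (t + ι k)
  v = inv (c - ι k)
  α = - 1ℚ + (c + c) * w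
  β = (c + c) * (w * w)

-ιa-ι[1+b]≢0 : ∀ a b → - ι a - ι (suc b) ≢ 0ℚ
-ιa-ι[1+b]≢0 a b e = ι-suc≢0 (a +ℕ b) (begin
  ι (suc (a +ℕ b))          ≡⟨ cong ι (sym (ℕ.+-suc a b)) ⟩
  ι (a +ℕ suc b)            ≡⟨ ι-+ a (suc b) ⟩
  ι a + ι (suc b)           ≡⟨ solve 2 (λ x y → x :+ y := :- (:- x :- y)) refl (ι a) (ι (suc b)) ⟩
  - (- ι a - ι (suc b))     ≡⟨ cong -_ e ⟩
  0ℚ                        ∎)

R₂≡ΠQ : ∀ N J → N < J → R₂ N (- ι J) ≡ Π N (- ι J) * Q N (- ι J)
R₂≡ΠQ zero J _ = begin
  1ℚ * (inv (t + 0ℚ) * inv (t + 0ℚ)) + 0ℚ     ≡⟨ cong (λ x → 1ℚ * (inv x * inv x) + 0ℚ) (+-identityʳ t) ⟩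
  1ℚ * (inv t * inv t) + 0ℚ                   ≡⟨ solve 1 (λ x → con 1ℚ :* (x :* x) :+ con 0ℚ := x :* (x :+ con 0ℚ :- con 0ℚ)) refl (inv t) ⟩
  inv t * (inv t + 0ℚ - 0ℚ)                   ≡⟨ cong (λ x → inv t * (inv x + 0ℚ - 0ℚ)) (sym (+-identityʳ t)) ⟩
  inv t * (inv (t + 0ℚ) + 0ℚ - 0ℚ)            ∎
  where
  t = - ι J
R₂≡ΠQ (suc N) J 1+N<J = begin
  R₂ (suc N) t
    ≡⟨ sum-last 0 (suc N) f ⟩
  sumFrom 0 (suc N) f + f (suc N)
    ≡⟨ cong (_+ f (suc N)) (sum-cong 0 (suc N) (λ k _ k<1+N →
         R₂-term-suc t k (ℕ.≤-pred k<1+N) (NonPole-neg N J N<J k (ℕ.≤-pred k<1+N)) t+c≢0)) ⟩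
  sumFrom 0 (suc N) (λ k → α * X₂ k + β * X₁ k + β * Y k) + f (suc N)
    ≡⟨ cong (_+ f (suc N)) (trans (sum-+ 0 (suc N) (λ k → α * X₂ k + β * X₁ k) (λ k → β * Y k))
         (cong₂ _+_ (trans (sum-+ 0 (suc N) (λ k → α * X₂ k) (λ k → β * X₁ k))
                           (cong₂ _+_ (sum-*ˡ 0 (suc N) α X₂) (sum-*ˡ 0 (suc N) β X₁)))
                    (sum-*ˡ 0 (suc N) β Y))) ⟩
  α * R₂ N t + β * R N t + β * sumFrom 0 (suc N) Y + f (suc N)
    ≡⟨ cong₂ (λ x y → α * x + β * y + β * sumFrom 0 (suc N) Y + f (suc N)) (R₂≡ΠQ N J N<J) (R≡Π N t (NonPole-neg N J N<J)) ⟩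
  α * (Π N t * Q N t) + β * Π N t + β * sumFrom 0 (suc N) Y + coeff (suc N) (suc N) * (w * w)
    ≡⟨ cong₂ (λ x y → α * (Π N t * Q N t) + β * Π N t + β * x + y * (w * w))
         (trans (sum-coeff/[1+N-k] N) (cong -_ (R≡Π N (- c) (NonPole-neg N (suc N) ℕ.≤-refl)))) (coeff-diagonal N) ⟩
  α * (Π N t * Q N t) + β * Π N t + β * (- Π N (- c)) + (c + c) * Π N (- c) * (w * w)
    ≡⟨ modulo₂ (Π N t * (Q N t + w)) (- (Π N t * w)) (inv-inverseʳ t+c≢0) (inv-inverseʳ (-ιa-ι[1+b]≢0 J N))
         (solve 7 (λ p q r c t w z → (:- con 1ℚ :+ (c :+ c) :* w) :* (p :* q) :+ (c :+ c) :* (w :* w) :* p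
                                       :+ (c :+ c) :* (w :* w) :* (:- r) :+ (c :+ c) :* r :* (w :* w)
                                     := p :* ((c :- t) :* w) :* (q :+ w :- z)
                                        :+ (p :* (q :+ w)) :* ((t :+ c) :* w :- con 1ℚ)
                                        :+ (:- (p :* w)) :* ((t :- c) :* z :- con 1ℚ)) refl
                  (Π N t) (Q N t) (Π N (- c)) c t w (inv (t - c))) ⟩
  Π (suc N) t * (Q N t + w - inv (t - c))
    ≡⟨ cong (Π (suc N) t *_) (sym (Q-suc N t)) ⟩
  Π (suc N) t * Q (suc N) t
    ∎
  where
  t = - ι J
  c = ι (suc N)
  w = inv (t + c)
  α = - 1ℚ + (c + c) * w
  β = (c + c) * (w * w)
  N<J : N < J
  N<J = ℕ.<-trans (ℕ.n<1+n N) 1+N<J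
  t+c≢0 : t + c ≢ 0ℚ
  t+c≢0 = NonPole-neg (suc N) J 1+N<J (suc N) ℕ.≤-refl
  f X₂ X₁ Y : ℕ → ℚ
  f k = coeff (suc N) k * (inv (t + ι k) * inv (t + ι k))
  X₂ k = coeff N k * (inv (t + ι k) * inv (t + ι k))
  X₁ k = coeff N k * inv (t + ι k)
  Y k = coeff N k * inv (c - ι k)

-- The k = j term is coeff N j * inv 0 = 0, so this is the sum over k ≢ j.
regularPart : ℕ → ℕ → ℚ
regularPart N j = sumFrom 0 (suc N) (λ k → coeff N k * inv (ι k - ι j))

harmonicWeight : ℕ → ℕ → ℚ
harmonicWeight N j = ι 2 * H 1 j - H 1 (N +ℕ j) - H 1 (N ∸ j)

Q-at-neg-suc : ∀ J → Q J (- ι (suc J)) ≡ - H 1 (suc J) + sumFrom 1 J (λ x → inv (ι (suc J +ℕ x)))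
Q-at-neg-suc J = begin
  sumFrom 0 (suc J) (λ i → inv (- c + ι i)) - sumFrom 1 J (λ i → inv (- c - ι i))
    ≡⟨ cong₂ _-_ first second ⟩
  - H 1 (suc J) - - T
    ≡⟨ solve 2 (λ h t → :- h :- (:- t) := :- h :+ t) refl (H 1 (suc J)) T ⟩
  - H 1 (suc J) + T
    ∎
  where
  c = ι (suc J)
  T = sumFrom 1 J (λ x → inv (ι (suc J +ℕ x)))
  first : sumFrom 0 (suc J) (λ i → inv (- c + ι i)) ≡ - H 1 (suc J)
  first = begin
    sumFrom 0 (suc J) (λ i → inv (- c + ι i))      ≡⟨ sum-ext 0 (suc J) (λ i → trans (cong inv (solve 2 (λ c i → :- c :+ i := :- (c :- i)) refl c (ι i))) (inv-neg (c - ι i))) ⟩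
    sumFrom 0 (suc J) (λ i → - inv (c - ι i))      ≡⟨ sum-neg 0 (suc J) (λ i → inv (c - ι i)) ⟩
    - sumFrom 0 (suc J) (λ i → inv (c - ι i))      ≡⟨ cong -_ (H₁-reversed J) ⟩
    - H 1 (suc J)                                  ∎
  second : sumFrom 1 J (λ i → inv (- c - ι i)) ≡ - T
  second = begin
    sumFrom 1 J (λ i → inv (- c - ι i))            ≡⟨ sum-ext 1 J (λ i → trans (cong inv (trans (solve 2 (λ c i → :- c :- i := :- (c :+ i)) refl c (ι i))
                                                                                            (cong -_ (sym (ι-+ (suc J) i)))))
                                                                         (inv-neg (ι (suc J +ℕ i)))) ⟩
    sumFrom 1 J (λ i → - inv (ι (suc J +ℕ i)))     ≡⟨ sum-neg 1 J (λ i → inv (ι (suc J +ℕ i))) ⟩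
    - T                                            ∎

H-double : ∀ J → H 1 (suc J +ℕ suc J) ≡ H 1 (suc J) + sumFrom 1 J (λ x → inv (ι (suc J +ℕ x))) + inv (ι (suc J) + ι (suc J))
H-double J = begin
  H 1 (suc J +ℕ suc J)               ≡⟨ cong (H 1) (ℕ.+-suc (suc J) J) ⟩
  H 1 (suc (suc J +ℕ J))             ≡⟨ H₁-suc (suc J +ℕ J) ⟩
  H 1 (suc J +ℕ J) + inv (ι (suc (suc J +ℕ J)))
    ≡⟨ cong₂ _+_ (trans (H-+ 1 (suc J) J) (cong (H 1 (suc J) +_) (sum-ext 1 J (λ x → *-identityʳ _))))
                 (cong inv (trans (cong ι (sym (ℕ.+-suc (suc J) J))) (ι-+ (suc J) (suc J)))) ⟩
  H 1 (suc J) + sumFrom 1 J (λ x → inv (ι (suc J +ℕ x))) + inv (ι (suc J) + ι (suc J))   ∎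

regularPart-term-diagonal : ∀ {J} k → k ≤ J →
  let c = ι (suc J)
      v = inv (c - ι k)
  in coeff (suc J) k * inv (ι k - c) ≡ (- (c + c)) * (coeff J k * (v * v)) + coeff J k * v
regularPart-term-diagonal {J} k k≤J = begin
  coeff (suc J) k * inv (ι k - c)
    ≡⟨ cong₂ _*_ (coeff-suc k≤J) (trans (cong inv (solve 2 (λ a b → a :- b := :- (b :- a)) refl (ι k) c)) (inv-neg (c - ι k))) ⟩
  coeff J k * (c + ι k) * v * (- v)
    ≡⟨ modulo₁ (coeff J k * v) (inv-inverseʳ (ιa-ιb≢0 (ℕ.>⇒≢ (s≤s k≤J))))
         (solve 4 (λ a c k v → a :* (c :+ k) :* v :* (:- v)
                              := (:- (c :+ c)) :* (a :* (v :* v)) :+ a :* v :+ (a :* v) :* ((c :- k) :* v :- con 1ℚ)) refl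
                  (coeff J k) c (ι k) v) ⟩
  (- (c + c)) * (coeff J k * (v * v)) + coeff J k * v
    ∎
  where
  c = ι (suc J)
  v = inv (c - ι k)

regularPart-diagonal : ∀ J → regularPart (suc J) (suc J) ≡ coeff (suc J) (suc J) * harmonicWeight (suc J) (suc J)
regularPart-diagonal J = begin
  regularPart (suc J) (suc J)
    ≡⟨ sum-last 0 (suc J) g ⟩
  sumFrom 0 (suc J) g + g (suc J)
    ≡⟨ cong₂ _+_ (sum-cong 0 (suc J) (λ k _ k<1+J → regularPart-term-diagonal k (ℕ.≤-pred k<1+J))) (trans (cong (λ x → coeff (suc J) (suc J) * inv x) (+-inverseʳ c)) (*-zeroʳ (coeff (suc J) (suc J)))) ⟩
  sumFrom 0 (suc J) (λ k → (- (c + c)) * W k + Y k) + 0ℚ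
    ≡⟨ cong (_+ 0ℚ) (trans (sum-+ 0 (suc J) (λ k → (- (c + c)) * W k) Y) (cong (_+ sumFrom 0 (suc J) Y) (sum-*ˡ 0 (suc J) (- (c + c)) W))) ⟩
  (- (c + c)) * sumFrom 0 (suc J) W + sumFrom 0 (suc J) Y + 0ℚ
    ≡⟨ cong₂ (λ x y → (- (c + c)) * x + y + 0ℚ) (trans ΣW≡R₂ (R₂≡ΠQ J (suc J) ℕ.≤-refl))
         (trans (sum-coeff/[1+N-k] J) (cong -_ (R≡Π J (- c) (NonPole-neg J (suc J) ℕ.≤-refl)))) ⟩
  (- (c + c)) * (Πc * Q J (- c)) + (- Πc) + 0ℚ
    ≡⟨ cong (λ q → (- (c + c)) * (Πc * q) + (- Πc) + 0ℚ) (Q-at-neg-suc J) ⟩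
  (- (c + c)) * (Πc * (- H 1 (suc J) + T)) + (- Πc) + 0ℚ
    ≡⟨ modulo₁ Πc (inv-inverseʳ 2c≢0)
         (solve 5 (λ p cc icc h t → (:- cc) :* (p :* (:- h :+ t)) :+ (:- p) :+ con 0ℚ
                                   := (cc :* p) :* (con (ι 2) :* h :- (h :+ t :+ icc) :- con 0ℚ) :+ p :* (cc :* icc :- con 1ℚ)) refl
                  Πc (c + c) (inv (c + c)) (H 1 (suc J)) T) ⟩
  ((c + c) * Πc) * (ι 2 * H 1 (suc J) - (H 1 (suc J) + T + inv (c + c)) - 0ℚ)
    ≡⟨ cong₂ (λ x y → x * (ι 2 * H 1 (suc J) - y - H 1 0)) (sym (coeff-diagonal J)) (sym (H-double J)) ⟩
  coeff (suc J) (suc J) * (ι 2 * H 1 (suc J) - H 1 (suc J +ℕ suc J) - H 1 0)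
    ≡⟨ cong (λ q → coeff (suc J) (suc J) * (ι 2 * H 1 (suc J) - H 1 (suc J +ℕ suc J) - H 1 q)) (sym (ℕ.n∸n≡0 J)) ⟩
  coeff (suc J) (suc J) * harmonicWeight (suc J) (suc J)
    ∎
  where
  c = ι (suc J)
  Πc = Π J (- c)
  T = sumFrom 1 J (λ x → inv (ι (suc J +ℕ x)))
  g W Y : ℕ → ℚ
  g k = coeff (suc J) k * inv (ι k - c)
  W k = coeff J k * (inv (c - ι k) * inv (c - ι k))
  Y k = coeff J k * inv (c - ι k)
  2c≢0 : c + c ≢ 0ℚ
  2c≢0 e = ι-suc≢0 (J +ℕ suc J) (trans (ι-+ (suc J) (suc J)) e)
  ΣW≡R₂ : sumFrom 0 (suc J) W ≡ R₂ J (- c)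
  ΣW≡R₂ = sum-ext 0 (suc J) (λ k → cong (coeff J k *_) (begin
    inv (c - ι k) * inv (c - ι k)             ≡⟨ solve 1 (λ v → v :* v := (:- v) :* (:- v)) refl (inv (c - ι k)) ⟩
    - inv (c - ι k) * - inv (c - ι k)         ≡⟨ cong (λ x → x * x) (sym (trans (cong inv (solve 2 (λ c k → :- c :+ k := :- (c :- k)) refl c (ι k))) (inv-neg (c - ι k)))) ⟩
    inv (- c + ι k) * inv (- c + ι k)         ∎))

regularPart-term-suc : ∀ {N j} k → j ≤ N → k ≤ N →
  let c = ι (suc N)
      y = inv (c - ι j)
  in coeff (suc N) k * inv (ι k - ι j)
     ≡ (c + ι j) * y * (coeff N k * inv (ι k - ι j)) + (c + c) * y * (coeff N k * inv (c - ι k))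
       + δ k j * (- ((c + c) * y * y * coeff N j))
regularPart-term-suc {N} {j} k j≤N k≤N = by-cases (k ℕ.≟ j)
  where
  c = ι (suc N)
  y = inv (c - ι j)
  y-inv : (- ι j + c) * y ≡ 1ℚ
  y-inv = trans (cong (_* y) (+-comm (- ι j) c)) (inv-inverseʳ (ιa-ιb≢0 (ℕ.>⇒≢ (s≤s j≤N))))
  by-cases : Dec (k ≡ j) → coeff (suc N) k * inv (ι k - ι j)
             ≡ (c + ι j) * y * (coeff N k * inv (ι k - ι j)) + (c + c) * y * (coeff N k * inv (c - ι k))
               + δ k j * (- ((c + c) * y * y * coeff N j))
  by-cases (yes refl) = begin
    coeff (suc N) k * inv (ι k - ι k)
      ≡⟨ trans (cong (λ x → coeff (suc N) k * inv x) (+-inverseʳ (ι k))) (*-zeroʳ (coeff (suc N) k)) ⟩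
    0ℚ
      ≡⟨ solve 4 (λ β γ a y → con 0ℚ := β :* (a :* con 0ℚ) :+ γ :* (a :* y) :+ con 1ℚ :* (:- (γ :* y :* a))) refl
           ((c + ι k) * y) ((c + c) * y) (coeff N k) y ⟩
    (c + ι k) * y * (coeff N k * inv 0ℚ) + (c + c) * y * (coeff N k * y) + 1ℚ * (- ((c + c) * y * y * coeff N k))
      ≡⟨ cong₂ (λ x d → (c + ι k) * y * (coeff N k * inv x) + (c + c) * y * (coeff N k * y) + d * (- ((c + c) * y * y * coeff N k)))
               (sym (+-inverseʳ (ι k))) (sym (δ-refl k)) ⟩
    (c + ι k) * y * (coeff N k * inv (ι k - ι k)) + (c + c) * y * (coeff N k * y) + δ k k * (- ((c + c) * y * y * coeff N k))
      ∎
  by-cases (no k≢j) = begin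
    coeff (suc N) k * z
      ≡⟨ cong (_* z) (coeff-suc k≤N) ⟩
    coeff N k * (c + ι k) * v * z
      ≡⟨ solve 4 (λ a b v z → a :* b :* v :* z := a :* (b :* v :* z)) refl (coeff N k) (c + ι k) v z ⟩
    coeff N k * ((c + ι k) * v * z)
      ≡⟨ cong (coeff N k *_) (partial-fractions₁ (- ι j) c (ι k) z v y
           (trans (cong (_* z) (+-comm (- ι j) (ι k))) (inv-inverseʳ (ιa-ιb≢0 k≢j)))
           (inv-inverseʳ (ιa-ιb≢0 (ℕ.>⇒≢ (s≤s k≤N)))) y-inv) ⟩
    coeff N k * ((c - - ι j) * y * z + (c + c) * y * v)
      ≡⟨ solve 7 (λ a c j y z v m → a :* ((c :- (:- j)) :* y :* z :+ (c :+ c) :* y :* v)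
                                   := (c :+ j) :* y :* (a :* z) :+ (c :+ c) :* y :* (a :* v) :+ con 0ℚ :* m) refl
           (coeff N k) c (ι j) y z v (- ((c + c) * y * y * coeff N j)) ⟩
    (c + ι j) * y * (coeff N k * z) + (c + c) * y * (coeff N k * v) + 0ℚ * (- ((c + c) * y * y * coeff N j))
      ≡⟨ cong (λ d → (c + ι j) * y * (coeff N k * z) + (c + c) * y * (coeff N k * v) + d * (- ((c + c) * y * y * coeff N j)))
              (sym (δ-≢ k≢j)) ⟩
    (c + ι j) * y * (coeff N k * z) + (c + c) * y * (coeff N k * v) + δ k j * (- ((c + c) * y * y * coeff N j))
      ∎
    where
    z = inv (ι k - ι j)
    v = inv (c - ι k)

harmonicWeight-suc : ∀ {N j} → j ≤ N →
  harmonicWeight (suc N) j ≡ harmonicWeight N j - inv (ι (suc N) + ι j) - inv (ι (suc N) - ι j)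
harmonicWeight-suc {N} {j} j≤N = begin
  ι 2 * H 1 j - H 1 (suc (N +ℕ j)) - H 1 (suc N ∸ j)
    ≡⟨ cong₂ (λ a b → ι 2 * H 1 j - a - b)
         (trans (H₁-suc (N +ℕ j)) (cong (λ x → H 1 (N +ℕ j) + inv x) (ι-+ (suc N) j)))
         (trans (cong (H 1) (ℕ.+-∸-assoc 1 j≤N))
           (trans (H₁-suc (N ∸ j)) (cong (λ x → H 1 (N ∸ j) + inv x)
             (trans (cong ι (sym (ℕ.+-∸-assoc 1 j≤N))) (ι-∸ (ℕ.m≤n⇒m≤1+n j≤N)))))) ⟩
  ι 2 * H 1 j - (H 1 (N +ℕ j) + inv (ι (suc N) + ι j)) - (H 1 (N ∸ j) + inv (ι (suc N) - ι j))
    ≡⟨ solve 5 (λ a b d r y → a :- (b :+ r) :- (d :+ y) := a :- b :- d :- r :- y) refl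
         (ι 2 * H 1 j) (H 1 (N +ℕ j)) (H 1 (N ∸ j)) (inv (ι (suc N) + ι j)) (inv (ι (suc N) - ι j)) ⟩
  harmonicWeight N j - inv (ι (suc N) + ι j) - inv (ι (suc N) - ι j)
    ∎

regularPart-suc : ∀ N j → j ≤ N → regularPart N j ≡ coeff N j * harmonicWeight N j →
                  regularPart (suc N) j ≡ coeff (suc N) j * harmonicWeight (suc N) j
regularPart-suc N j j≤N hyp = begin
  regularPart (suc N) j
    ≡⟨ sum-last 0 (suc N) g ⟩
  sumFrom 0 (suc N) g + g (suc N)
    ≡⟨ cong (_+ g (suc N)) (sum-cong 0 (suc N) (λ k _ k<1+N → regularPart-term-suc k j≤N (ℕ.≤-pred k<1+N))) ⟩
  sumFrom 0 (suc N) (λ k → β * Z k + γ * Y k + δ k j * M) + g (suc N)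
    ≡⟨ cong (_+ g (suc N)) (trans (sum-+ 0 (suc N) (λ k → β * Z k + γ * Y k) (λ k → δ k j * M))
         (cong₂ _+_ (trans (sum-+ 0 (suc N) (λ k → β * Z k) (λ k → γ * Y k))
                           (cong₂ _+_ (sum-*ˡ 0 (suc N) β Z) (sum-*ˡ 0 (suc N) γ Y)))
                    (sum-δ 0 (suc N) j M z≤n (s≤s j≤N)))) ⟩
  β * regularPart N j + γ * sumFrom 0 (suc N) Y + M + coeff (suc N) (suc N) * y
    ≡⟨ cong₂ (λ x y′ → β * x + γ * y′ + M + coeff (suc N) (suc N) * y) hyp
         (trans (sum-coeff/[1+N-k] N) (cong -_ (R≡Π N (- c) (NonPole-neg N (suc N) ℕ.≤-refl)))) ⟩
  β * (coeff N j * harmonicWeight N j) + γ * (- Π N (- c)) + M + coeff (suc N) (suc N) * y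
    ≡⟨ cong (λ x → β * (coeff N j * harmonicWeight N j) + γ * (- Π N (- c)) + M + x * y) (coeff-diagonal N) ⟩
  β * (coeff N j * harmonicWeight N j) + γ * (- Π N (- c)) + M + (c + c) * Π N (- c) * y
    ≡⟨ modulo₂ (coeff N j * y) (- (coeff N j * y)) (inv-inverseʳ c+j≢0) (inv-inverseʳ c-j≢0)
         (solve 7 (λ a h r c j y i → (c :+ j) :* y :* (a :* h) :+ (c :+ c) :* y :* (:- r) :+ (:- ((c :+ c) :* y :* y :* a)) :+ (c :+ c) :* r :* y
                                   := (a :* (c :+ j) :* y) :* (h :- i :- y) :+ (a :* y) :* ((c :+ j) :* i :- con 1ℚ)
                                      :+ (:- (a :* y)) :* ((c :- j) :* y :- con 1ℚ)) refl
                  (coeff N j) (harmonicWeight N j) (Π N (- c)) c (ι j) y (inv (c + ι j))) ⟩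
  coeff N j * (c + ι j) * y * (harmonicWeight N j - inv (c + ι j) - y)
    ≡⟨ cong₂ _*_ (sym (coeff-suc j≤N)) (sym (harmonicWeight-suc j≤N)) ⟩
  coeff (suc N) j * harmonicWeight (suc N) j
    ∎
  where
  c = ι (suc N)
  y = inv (c - ι j)
  β = (c + ι j) * y
  γ = (c + c) * y
  M = - (γ * y * coeff N j)
  g Z Y : ℕ → ℚ
  g k = coeff (suc N) k * inv (ι k - ι j)
  Z k = coeff N k * inv (ι k - ι j)
  Y k = coeff N k * inv (c - ι k)
  c+j≢0 : c + ι j ≢ 0ℚ
  c+j≢0 e = ι-suc≢0 (N +ℕ j) (trans (ι-+ (suc N) j) e)
  c-j≢0 : c - ι j ≢ 0ℚ
  c-j≢0 = ιa-ιb≢0 (ℕ.>⇒≢ (s≤s j≤N))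

regularPart≡coeff*harmonicWeight : ∀ N j → j ≤ N → regularPart N j ≡ coeff N j * harmonicWeight N j
regularPart≡coeff*harmonicWeight zero zero z≤n = refl
regularPart≡coeff*harmonicWeight (suc N) j j≤1+N with ℕ.m≤n⇒m<n∨m≡n j≤1+N
... | inj₁ (s≤s j≤N) = regularPart-suc N j j≤N (regularPart≡coeff*harmonicWeight N j j≤N)
... | inj₂ refl = regularPart-diagonal N

-- Partial fractions of a product of two such rational functions

module ProductExpansion (M : ℕ) (a b : ℕ → ℚ) (t : ℚ) (t-regular : NonPole M t) where

  Σ : (ℕ → ℚ) → ℚ
  Σ f = sumFrom 0 (suc M) f

  u : ℕ → ℚ
  u j = inv (t + ι j)

  z : ℕ → ℕ → ℚ
  z k j = inv (ι k - ι j)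

  crossᵇ crossᵃ mixed diagonal : ℕ → ℚ
  crossᵇ j = Σ (λ k → b k * z k j)
  crossᵃ j = Σ (λ k → a k * z k j)
  mixed j = a j * crossᵇ j + b j * crossᵃ j
  diagonal j = a j * b j * (u j * u j)

  u-inv : ∀ j → j ≤ M → (t + ι j) * u j ≡ 1ℚ
  u-inv j j≤M = inv-inverseʳ (t-regular j j≤M)

  z-antisym : ∀ k j → z k j ≡ - z j k
  z-antisym k j = trans (cong inv (solve 2 (λ x y → x :- y := :- (y :- x)) refl (ι k) (ι j))) (inv-neg (ι j - ι k))

  u*u≡[u-u]*z : ∀ j k → j ≤ M → k ≤ M → j ≢ k → u j * u k ≡ (u j - u k) * z k j
  u*u≡[u-u]*z j k j≤M k≤M j≢k = modulo₃ (- (u j * u k)) (u j * z k j) (- (u k * z k j))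
    (inv-inverseʳ (ιa-ιb≢0 (j≢k ∘ sym))) (u-inv k k≤M) (u-inv j j≤M)
    (solve 6 (λ uj uk z t j k → uj :* uk := (uj :- uk) :* z :+ (:- (uj :* uk)) :* ((k :- j) :* z :- con 1ℚ)
                                 :+ (uj :* z) :* ((t :+ k) :* uk :- con 1ℚ) :+ (:- (uk :* z)) :* ((t :+ j) :* uj :- con 1ℚ)) refl
             (u j) (u k) (z k j) t (ι j) (ι k))

  -- Since z j j = inv 0 = 0, the diagonal k = j contributes only through δ.
  product-term : ∀ j k → j ≤ M → k ≤ M →
                 (a j * u j) * (b k * u k) ≡ (a j * b k * u j * z k j - a j * b k * u k * z k j) + δ k j * diagonal j
  product-term j k j≤M k≤M = by-cases (k ℕ.≟ j)
    where
    by-cases : Dec (k ≡ j) → (a j * u j) * (b k * u k) ≡ (a j * b k * u j * z k j - a j * b k * u k * z k j) + δ k j * diagonal j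
    by-cases (yes refl) = trans
      (solve 3 (λ a b u → (a :* u) :* (b :* u) := (a :* b :* u :* con 0ℚ :- a :* b :* u :* con 0ℚ) :+ con 1ℚ :* (a :* b :* (u :* u))) refl
             (a k) (b k) (u k))
      (cong₂ (λ x d → (a k * b k * u k * inv x - a k * b k * u k * inv x) + d * diagonal k) (sym (+-inverseʳ (ι k))) (sym (δ-refl k)))
    by-cases (no k≢j) = begin
      (a j * u j) * (b k * u k)                                     ≡⟨ solve 4 (λ a b x y → (a :* x) :* (b :* y) := a :* b :* (x :* y)) refl (a j) (b k) (u j) (u k) ⟩
      a j * b k * (u j * u k)                                       ≡⟨ cong (a j * b k *_) (u*u≡[u-u]*z j k j≤M k≤M (k≢j ∘ sym)) ⟩
      a j * b k * ((u j - u k) * z k j)                             ≡⟨ solve 6 (λ a b x y z d → a :* b :* ((x :- y) :* z) := (a :* b :* x :* z :- a :* b :* y :* z) :+ con 0ℚ :* d) refl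
                                                                         (a j) (b k) (u j) (u k) (z k j) (diagonal j) ⟩
      (a j * b k * u j * z k j - a j * b k * u k * z k j) + 0ℚ * diagonal j
                                                                    ≡⟨ cong (λ d → (a j * b k * u j * z k j - a j * b k * u k * z k j) + d * diagonal j) (sym (δ-≢ k≢j)) ⟩
      (a j * b k * u j * z k j - a j * b k * u k * z k j) + δ k j * diagonal j   ∎

  product-row : ∀ j → j ≤ M →
                Σ (λ k → (a j * u j) * (b k * u k)) ≡ diagonal j + (u j * (a j * crossᵇ j) - Σ (λ k → a j * b k * u k * z k j))
  product-row j j≤M = begin
    Σ (λ k → (a j * u j) * (b k * u k))
      ≡⟨ sum-cong 0 (suc M) (λ k _ k<1+M → product-term j k j≤M (ℕ.≤-pred k<1+M)) ⟩
    Σ (λ k → (a j * b k * u j * z k j - a j * b k * u k * z k j) + δ k j * diagonal j)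
      ≡⟨ sum-+ 0 (suc M) (λ k → a j * b k * u j * z k j - a j * b k * u k * z k j) (λ k → δ k j * diagonal j) ⟩
    Σ (λ k → a j * b k * u j * z k j - a j * b k * u k * z k j) + Σ (λ k → δ k j * diagonal j)
      ≡⟨ cong₂ _+_ (sum-- 0 (suc M) (λ k → a j * b k * u j * z k j) (λ k → a j * b k * u k * z k j)) (sum-δ 0 (suc M) j (diagonal j) z≤n (s≤s j≤M)) ⟩
    Σ (λ k → a j * b k * u j * z k j) - Σ (λ k → a j * b k * u k * z k j) + diagonal j
      ≡⟨ cong (λ q → q - Σ (λ k → a j * b k * u k * z k j) + diagonal j)
           (trans (sum-ext 0 (suc M) (λ k → solve 4 (λ a b u z → a :* b :* u :* z := (u :* a) :* (b :* z)) refl (a j) (b k) (u j) (z k j)))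
                  (sum-*ˡ 0 (suc M) (u j * a j) (λ k → b k * z k j))) ⟩
    (u j * a j) * crossᵇ j - Σ (λ k → a j * b k * u k * z k j) + diagonal j
      ≡⟨ solve 5 (λ u a B s d → (u :* a) :* B :- s :+ d := d :+ (u :* (a :* B) :- s)) refl
           (u j) (a j) (crossᵇ j) (Σ (λ k → a j * b k * u k * z k j)) (diagonal j) ⟩
    diagonal j + (u j * (a j * crossᵇ j) - Σ (λ k → a j * b k * u k * z k j))
      ∎

  sum-product-rows : Σ (λ j → Σ (λ k → a j * b k * u k * z k j)) ≡ - Σ (λ k → u k * (b k * crossᵃ k))
  sum-product-rows = begin
    Σ (λ j → Σ (λ k → a j * b k * u k * z k j))
      ≡⟨ sum-swap 0 (suc M) 0 (suc M) (λ j k → a j * b k * u k * z k j) ⟩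
    Σ (λ k → Σ (λ j → a j * b k * u k * z k j))
      ≡⟨ sum-ext 0 (suc M) (λ k → begin
           Σ (λ j → a j * b k * u k * z k j)
             ≡⟨ sum-ext 0 (suc M) (λ j → trans (cong (a j * b k * u k *_) (z-antisym k j))
                  (solve 4 (λ a b u z → a :* b :* u :* (:- z) := (:- (u :* b)) :* (a :* z)) refl (a j) (b k) (u k) (z j k))) ⟩
           Σ (λ j → - (u k * b k) * (a j * z j k))
             ≡⟨ sum-*ˡ 0 (suc M) (- (u k * b k)) (λ j → a j * z j k) ⟩
           - (u k * b k) * crossᵃ k
             ≡⟨ solve 3 (λ u b B → (:- (u :* b)) :* B := :- (u :* (b :* B))) refl (u k) (b k) (crossᵃ k) ⟩
           - (u k * (b k * crossᵃ k))
             ∎) ⟩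
    Σ (λ k → - (u k * (b k * crossᵃ k)))
      ≡⟨ sum-neg 0 (suc M) (λ k → u k * (b k * crossᵃ k)) ⟩
    - Σ (λ k → u k * (b k * crossᵃ k))
      ∎

  sum-products : Σ (λ j → Σ (λ k → (a j * u j) * (b k * u k))) ≡ Σ diagonal + Σ (λ j → u j * mixed j)
  sum-products = begin
    Σ (λ j → Σ (λ k → (a j * u j) * (b k * u k)))
      ≡⟨ sum-cong 0 (suc M) (λ j _ j<1+M → product-row j (ℕ.≤-pred j<1+M)) ⟩
    Σ (λ j → diagonal j + (u j * (a j * crossᵇ j) - Σ (λ k → a j * b k * u k * z k j)))
      ≡⟨ trans (sum-+ 0 (suc M) diagonal _) (cong (Σ diagonal +_) (sum-- 0 (suc M) (λ j → u j * (a j * crossᵇ j)) _)) ⟩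
    Σ diagonal + (Σ (λ j → u j * (a j * crossᵇ j)) - Σ (λ j → Σ (λ k → a j * b k * u k * z k j)))
      ≡⟨ cong (λ q → Σ diagonal + (Σ (λ j → u j * (a j * crossᵇ j)) - q)) sum-product-rows ⟩
    Σ diagonal + (Σ (λ j → u j * (a j * crossᵇ j)) - - Σ (λ k → u k * (b k * crossᵃ k)))
      ≡⟨ cong (Σ diagonal +_) (solve 2 (λ x y → x :- (:- y) := x :+ y) refl (Σ (λ j → u j * (a j * crossᵇ j))) (Σ (λ k → u k * (b k * crossᵃ k)))) ⟩
    Σ diagonal + (Σ (λ j → u j * (a j * crossᵇ j)) + Σ (λ k → u k * (b k * crossᵃ k)))
      ≡⟨ cong (Σ diagonal +_) (sym (trans (sum-ext 0 (suc M) (λ j → *-distribˡ-+ (u j) (a j * crossᵇ j) (b j * crossᵃ j)))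
                                          (sum-+ 0 (suc M) (λ j → u j * (a j * crossᵇ j)) (λ j → u j * (b j * crossᵃ j))))) ⟩
    Σ diagonal + Σ (λ j → u j * mixed j)
      ∎

  -- The double sum Σⱼ Σₖ aⱼ bₖ /(k-j) is antisymmetric under j ↔ k.
  sum-mixed≡0 : Σ mixed ≡ 0ℚ
  sum-mixed≡0 = begin
    Σ mixed
      ≡⟨ sum-+ 0 (suc M) (λ j → a j * crossᵇ j) (λ j → b j * crossᵃ j) ⟩
    Σ (λ j → a j * crossᵇ j) + Σ (λ j → b j * crossᵃ j)
      ≡⟨ cong₂ _+_ (sum-ext 0 (suc M) (λ j → sym (sum-*ˡ 0 (suc M) (a j) (λ k → b k * z k j))))
                   (sum-ext 0 (suc M) (λ j → sym (sum-*ˡ 0 (suc M) (b j) (λ k → a k * z k j)))) ⟩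
    S + Σ (λ j → Σ (λ k → b j * (a k * z k j)))
      ≡⟨ cong (S +_) (sum-swap 0 (suc M) 0 (suc M) (λ j k → b j * (a k * z k j))) ⟩
    S + Σ (λ k → Σ (λ j → b j * (a k * z k j)))
      ≡⟨ cong (S +_) (trans (sum-ext 0 (suc M) (λ k → trans
           (sum-ext 0 (suc M) (λ j → trans (cong (λ q → b j * (a k * q)) (z-antisym k j))
                                           (solve 3 (λ b a z → b :* (a :* (:- z)) := :- (a :* (b :* z))) refl (b j) (a k) (z j k))))
           (sum-neg 0 (suc M) (λ j → a k * (b j * z j k)))))
         (sum-neg 0 (suc M) (λ k → Σ (λ j → a k * (b j * z j k))))) ⟩
    S + - S
      ≡⟨ +-inverseʳ S ⟩
    0ℚ
      ∎
    where
    S = Σ (λ j → Σ (λ k → a j * (b k * z k j)))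

  term : ℕ → ℚ
  term j = a j * b j * (u j - ι j * (u j * u j)) - ι j * mixed j * u j

  t*product≡sum-term : t * (Σ (λ j → a j * u j) * Σ (λ k → b k * u k)) ≡ Σ term
  t*product≡sum-term = begin
    t * (Σ (λ j → a j * u j) * Σ (λ k → b k * u k))
      ≡⟨ cong (t *_) (trans (sum-*-sum 0 (suc M) 0 (suc M) (λ j → a j * u j) (λ k → b k * u k)) sum-products) ⟩
    t * (Σ diagonal + Σ (λ j → u j * mixed j))
      ≡⟨ trans (*-distribˡ-+ t (Σ diagonal) _) (cong₂ _+_ (sym (sum-*ˡ 0 (suc M) t diagonal)) (sym (sum-*ˡ 0 (suc M) t (λ j → u j * mixed j)))) ⟩
    Σ (λ j → t * diagonal j) + Σ (λ j → t * (u j * mixed j))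
      ≡⟨ sym (sum-+ 0 (suc M) (λ j → t * diagonal j) (λ j → t * (u j * mixed j))) ⟩
    Σ (λ j → t * diagonal j + t * (u j * mixed j))
      ≡⟨ sum-cong 0 (suc M) {g = λ j → term j + mixed j} (λ j _ j<1+M → modulo₁ (a j * b j * u j + mixed j) (u-inv j (ℕ.≤-pred j<1+M))
           (solve 6 (λ t j a b u c → t :* (a :* b :* (u :* u)) :+ t :* (u :* c)
                                    := (a :* b :* (u :- j :* (u :* u)) :- j :* c :* u) :+ c :+ (a :* b :* u :+ c) :* ((t :+ j) :* u :- con 1ℚ)) refl
                    t (ι j) (a j) (b j) (u j) (mixed j))) ⟩
    Σ (λ j → term j + mixed j)
      ≡⟨ trans (sum-+ 0 (suc M) term mixed) (cong (Σ term +_) sum-mixed≡0) ⟩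
    Σ term + 0ℚ
      ≡⟨ +-identityʳ (Σ term) ⟩
    Σ term
      ∎

-- The identity on U = 1/(k + x), V = U², and by linearity

harmonicSum : ℕ → ℕ → ℕ → ℚ
harmonicSum m n k = H 1 (m +ℕ k) + H 1 (m ∸ k) + H 1 (n +ℕ k) + H 1 (n ∸ k) - ι 4 * H 1 k

binomials₃ binomials₄ : ℕ → ℕ → ℕ → ℕ
binomials₃ m n k = ((m +ℕ k) C k) *ℕ (m C k) *ℕ ((n +ℕ k) C k)
binomials₄ m n k = binomials₃ m n k *ℕ (n C k)

highCoeff : ℕ → ℕ → ℕ → ℚ
highCoeff m n k = (((- 1ℚ) ^ℚ (k ∸ n)) * ι (binomials₃ m n k)) /ℕ ((k ∸ 1) C n)

-- RHS p m n C₁ C₂ unfolds to Φ m n (Uₖ p m n C₁ C₂) (Vₖ p m n C₁ C₂).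
Φ : ℕ → ℕ → (ℕ → ℚ) → (ℕ → ℚ) → ℚ
Φ m n U V = sumFrom 0 (suc n) (λ k → ι (binomials₄ m n k) * ((1ℚ + ι k * harmonicSum m n k) * U k - ι k * V k))
          + sumFrom (suc n) (m ∸ n) (λ k → highCoeff m n k * U k)

harmonicSum≡ : ∀ m n k → harmonicSum m n k ≡ - (harmonicWeight m k + harmonicWeight n k)
harmonicSum≡ m n k = trans (cong (λ q → H 1 (m +ℕ k) + H 1 (m ∸ k) + H 1 (n +ℕ k) + H 1 (n ∸ k) - q * H 1 k) (ι-+ 2 2))
  (solve 6 (λ two h a b c d → a :+ b :+ c :+ d :- (two :+ two) :* h := :- ((two :* h :- a :- b) :+ (two :* h :- c :- d))) refl
           (ι 2) (H 1 k) (H 1 (m +ℕ k)) (H 1 (m ∸ k)) (H 1 (n +ℕ k)) (H 1 (n ∸ k)))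

coeff*coeff≡binomials₄ : ∀ m n k → coeff m k * coeff n k ≡ ι (binomials₄ m n k)
coeff*coeff≡binomials₄ m n k = begin
  sign k * ι (magnitude m k) * (sign k * ι (magnitude n k))
    ≡⟨ solve 3 (λ s A B → (s :* A) :* (s :* B) := (s :* s) :* (A :* B)) refl (sign k) (ι (magnitude m k)) (ι (magnitude n k)) ⟩
  sign k * sign k * (ι (magnitude m k) * ι (magnitude n k))
    ≡⟨ cong (_* (ι (magnitude m k) * ι (magnitude n k))) (sign*sign≡1 k) ⟩
  1ℚ * (ι (magnitude m k) * ι (magnitude n k))
    ≡⟨ trans (*-identityˡ _) (sym (ι-* (magnitude m k) (magnitude n k))) ⟩
  ι (magnitude m k *ℕ magnitude n k)
    ≡⟨ cong ι (sym (ℕ.*-assoc (magnitude m k) ((n +ℕ k) C k) (n C k))) ⟩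
  ι (binomials₄ m n k)
    ∎

module _ {m n : ℕ} (n≤m : n ≤ m) (x : ℕ) where

  open ProductExpansion m (coeff m) (coeff n) (ι (suc x)) (NonPole-pos m x)

  U V : ℕ → ℚ
  U k = inv (ι (k +ℕ suc x)) ^ℚ 1
  V k = inv (ι (k +ℕ suc x)) ^ℚ 2

  inv[k+1+x]≡u : ∀ k → inv (ι (k +ℕ suc x)) ≡ u k
  inv[k+1+x]≡u k = cong inv (trans (ι-+ k (suc x)) (+-comm (ι k) (ι (suc x))))

  U≡u : ∀ k → U k ≡ u k
  U≡u k = trans (*-identityʳ (inv (ι (k +ℕ suc x)))) (inv[k+1+x]≡u k)

  V≡u*u : ∀ k → V k ≡ u k * u k
  V≡u*u k = trans (cong (inv (ι (k +ℕ suc x)) *_) (*-identityʳ (inv (ι (k +ℕ suc x)))))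
                  (cong₂ _*_ (inv[k+1+x]≡u k) (inv[k+1+x]≡u k))

  crossᵇ-truncated : ∀ j → crossᵇ j ≡ sumFrom 0 (suc n) (λ k → coeff n k * z k j)
  crossᵇ-truncated j = sum-truncate n m (λ k → coeff n k * z k j) n≤m
    (λ k n<k → trans (cong (_* z k j) (coeff-vanishes n<k)) (*-zeroˡ (z k j)))

  low-term : ∀ j → j ≤ n → ι (binomials₄ m n j) * ((1ℚ + ι j * harmonicSum m n j) * U j - ι j * V j) ≡ term j
  low-term j j≤n = begin
    ι (binomials₄ m n j) * ((1ℚ + ι j * harmonicSum m n j) * U j - ι j * V j)
      ≡⟨ cong₂ (λ c h → c * ((1ℚ + ι j * h) * U j - ι j * V j)) (sym (coeff*coeff≡binomials₄ m n j)) (harmonicSum≡ m n j) ⟩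
    (a * b) * ((1ℚ + ι j * - (hm + hn)) * U j - ι j * V j)
      ≡⟨ cong₂ (λ p q → (a * b) * ((1ℚ + ι j * - (hm + hn)) * p - ι j * q)) (U≡u j) (V≡u*u j) ⟩
    (a * b) * ((1ℚ + ι j * - (hm + hn)) * u j - ι j * (u j * u j))
      ≡⟨ solve 6 (λ a b hm hn j u → (a :* b) :* ((con 1ℚ :+ j :* (:- (hm :+ hn))) :* u :- j :* (u :* u))
                                   := a :* b :* (u :- j :* (u :* u)) :- j :* (a :* (b :* hn) :+ b :* (a :* hm)) :* u) refl
           a b hm hn (ι j) (u j) ⟩
    a * b * (u j - ι j * (u j * u j)) - ι j * (a * (b * hn) + b * (a * hm)) * u j
      ≡⟨ cong₂ (λ p q → a * b * (u j - ι j * (u j * u j)) - ι j * (a * p + b * q) * u j)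
           (sym (trans (crossᵇ-truncated j) (regularPart≡coeff*harmonicWeight n j j≤n)))
           (sym (regularPart≡coeff*harmonicWeight m j (ℕ.≤-trans j≤n n≤m))) ⟩
    term j
      ∎
    where
    a = coeff m j
    b = coeff n j
    hm = harmonicWeight m j
    hn = harmonicWeight n j

  crossᵇ-high : ∀ j → n < j → crossᵇ j ≡ (- sign n) * ι ((j +ℕ n) C j) * inv (ι j) * inv (ι ((j ∸ 1) C n))
  crossᵇ-high j n<j = begin
    crossᵇ j                                               ≡⟨ crossᵇ-truncated j ⟩
    sumFrom 0 (suc n) (λ k → coeff n k * inv (ι k - ι j))  ≡⟨ sum-ext 0 (suc n) (λ k → cong (λ q → coeff n k * inv q) (+-comm (ι k) (- ι j))) ⟩
    R n (- ι j)                                            ≡⟨ R≡Π n (- ι j) (NonPole-neg n j n<j) ⟩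
    Π n (- ι j)                                            ≡⟨ Π-neg n j n<j ⟩
    (- sign n) * ι ((j +ℕ n) C j) * inv (ι j) * inv (ι ((j ∸ 1) C n))   ∎

  high-term : ∀ j → n < j → highCoeff m n j * U j ≡ term j
  high-term (suc j) (s≤s n≤j) = sym (begin
    term (suc j)
      ≡⟨ cong₂ (λ b B → a * b * (u (suc j) - ι (suc j) * (u (suc j) * u (suc j))) - ι (suc j) * (a * B + b * crossᵃ (suc j)) * u (suc j))
           (coeff-vanishes (s≤s n≤j)) (crossᵇ-high (suc j) (s≤s n≤j)) ⟩
    a * 0ℚ * (u (suc j) - ι (suc j) * (u (suc j) * u (suc j))) - ι (suc j) * (a * ((- σ) * B * inv (ι (suc j)) * iC) + 0ℚ * crossᵃ (suc j)) * u (suc j)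
      ≡⟨ cong (λ s → s * ι A * 0ℚ * (u (suc j) - ι (suc j) * (u (suc j) * u (suc j))) - ι (suc j) * (s * ι A * ((- σ) * B * inv (ι (suc j)) * iC) + 0ℚ * crossᵃ (suc j)) * u (suc j))
              sign-split ⟩
    τ * σ * ι A * 0ℚ * (u (suc j) - ι (suc j) * (u (suc j) * u (suc j))) - ι (suc j) * (τ * σ * ι A * ((- σ) * B * inv (ι (suc j)) * iC) + 0ℚ * crossᵃ (suc j)) * u (suc j)
      ≡⟨ modulo₂ (τ * ι A * B * iC * u (suc j) * (ι (suc j) * inv (ι (suc j)))) (τ * ι A * B * iC * u (suc j))
           (sign*sign≡1 n) (inv-inverseʳ (ι-suc≢0 j))
           (solve 10 (λ τ σ A B iC u j ij w X → τ :* σ :* A :* con 0ℚ :* w :- j :* (τ :* σ :* A :* ((:- σ) :* B :* ij :* iC) :+ con 0ℚ :* X) :* u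
                                             := τ :* (A :* B) :* iC :* u :+ (τ :* A :* B :* iC :* u :* (j :* ij)) :* (σ :* σ :- con 1ℚ)
                                                :+ (τ :* A :* B :* iC :* u) :* (j :* ij :- con 1ℚ)) refl
                      τ σ (ι A) B iC (u (suc j)) (ι (suc j)) (inv (ι (suc j))) (u (suc j) - ι (suc j) * (u (suc j) * u (suc j))) (crossᵃ (suc j))) ⟩
    τ * (ι A * B) * iC * u (suc j)
      ≡⟨ cong (λ q → τ * q * iC * u (suc j)) (sym (trans (ι-* A _) (cong (λ q → ι A * ι (q C suc j)) (ℕ.+-comm n (suc j))))) ⟩
    τ * ι (binomials₃ m n (suc j)) * iC * u (suc j)
      ≡⟨ sym (cong₂ _*_ (/ℕ≡*inv (τ * ι (binomials₃ m n (suc j))) (nCk≢0 n≤j)) (U≡u (suc j))) ⟩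
    highCoeff m n (suc j) * U (suc j)
      ∎)
    where
    σ = sign n
    τ = sign (suc j ∸ n)
    a = coeff m (suc j)
    A = ((m +ℕ suc j) C suc j) *ℕ (m C suc j)
    B = ι ((suc j +ℕ n) C suc j)
    iC = inv (ι (j C n))
    sign-split : sign (suc j) ≡ τ * σ
    sign-split = trans (cong sign (sym (ℕ.m∸n+n≡m (ℕ.m≤n⇒m≤1+n n≤j)))) (sign-+ (suc j ∸ n) n)

  Φ-basis≡0 : suc x ≤ m → Φ m n U V ≡ 0ℚ
  Φ-basis≡0 1+x≤m = begin
    Φ m n U V
      ≡⟨ cong₂ _+_ (sum-cong 0 (suc n) (λ j _ j<1+n → low-term j (ℕ.≤-pred j<1+n)))
                   (sum-cong (suc n) (m ∸ n) (λ j n<j _ → high-term j n<j)) ⟩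
    sumFrom 0 (suc n) term + sumFrom (suc n) (m ∸ n) term
      ≡⟨ sym (sum-split 0 (suc n) (m ∸ n) term) ⟩
    sumFrom 0 (suc n +ℕ (m ∸ n)) term
      ≡⟨ cong (λ l → sumFrom 0 (suc l) term) (ℕ.m+[n∸m]≡n n≤m) ⟩
    Σ term
      ≡⟨ sym t*product≡sum-term ⟩
    ι (suc x) * (R m (ι (suc x)) * Σ (λ k → coeff n k * u k))
      ≡⟨ cong (λ q → ι (suc x) * (q * Σ (λ k → coeff n k * u k)))
           (trans (R≡Π m (ι (suc x)) (NonPole-pos m x)) (Π-zero m (suc x) (s≤s z≤n) 1+x≤m)) ⟩
    ι (suc x) * (0ℚ * Σ (λ k → coeff n k * u k))
      ≡⟨ trans (cong (ι (suc x) *_) (*-zeroˡ (Σ (λ k → coeff n k * u k)))) (*-zeroʳ (ι (suc x))) ⟩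
    0ℚ
      ∎

Φ-cong : ∀ m n {U U′ V V′ : ℕ → ℚ} → (∀ k → U k ≡ U′ k) → (∀ k → V k ≡ V′ k) → Φ m n U V ≡ Φ m n U′ V′
Φ-cong m n U≡U′ V≡V′ = cong₂ _+_
  (sum-ext 0 (suc n) (λ k → cong₂ (λ u v → ι (binomials₄ m n k) * ((1ℚ + ι k * harmonicSum m n k) * u - ι k * v)) (U≡U′ k) (V≡V′ k)))
  (sum-ext (suc n) (m ∸ n) (λ k → cong (highCoeff m n k *_) (U≡U′ k)))

Φ-linear : ∀ m n c₁ c₂ (U₁ U₂ V₁ V₂ : ℕ → ℚ) →
           Φ m n (λ k → c₁ * U₁ k + c₂ * U₂ k) (λ k → c₁ * V₁ k + c₂ * V₂ k) ≡ c₁ * Φ m n U₁ V₁ + c₂ * Φ m n U₂ V₂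
Φ-linear m n c₁ c₂ U₁ U₂ V₁ V₂ = trans (cong₂ _+_ low high)
  (solve 6 (λ a b c d x y → x :* a :+ y :* b :+ (x :* c :+ y :* d) := x :* (a :+ c) :+ y :* (b :+ d)) refl _ _ _ _ c₁ c₂)
  where
  low-summand : (ℕ → ℚ) → (ℕ → ℚ) → ℕ → ℚ
  low-summand U V k = ι (binomials₄ m n k) * ((1ℚ + ι k * harmonicSum m n k) * U k - ι k * V k)
  high-summand : (ℕ → ℚ) → ℕ → ℚ
  high-summand U k = highCoeff m n k * U k
  combine : ∀ a l (f g : ℕ → ℚ) → sumFrom a l (λ k → c₁ * f k + c₂ * g k) ≡ c₁ * sumFrom a l f + c₂ * sumFrom a l g
  combine a l f g = trans (sum-+ a l (λ k → c₁ * f k) (λ k → c₂ * g k)) (cong₂ _+_ (sum-*ˡ a l c₁ f) (sum-*ˡ a l c₂ g))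
  low : sumFrom 0 (suc n) (low-summand (λ k → c₁ * U₁ k + c₂ * U₂ k) (λ k → c₁ * V₁ k + c₂ * V₂ k))
        ≡ c₁ * sumFrom 0 (suc n) (low-summand U₁ V₁) + c₂ * sumFrom 0 (suc n) (low-summand U₂ V₂)
  low = trans (sum-ext 0 (suc n) (λ k →
    solve 9 (λ a b j x y u₁ u₂ v₁ v₂ → a :* (b :* (x :* u₁ :+ y :* u₂) :- j :* (x :* v₁ :+ y :* v₂))
                                      := x :* (a :* (b :* u₁ :- j :* v₁)) :+ y :* (a :* (b :* u₂ :- j :* v₂))) refl
            (ι (binomials₄ m n k)) (1ℚ + ι k * harmonicSum m n k) (ι k) c₁ c₂ (U₁ k) (U₂ k) (V₁ k) (V₂ k)))
    (combine 0 (suc n) (low-summand U₁ V₁) (low-summand U₂ V₂))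
  high : sumFrom (suc n) (m ∸ n) (high-summand (λ k → c₁ * U₁ k + c₂ * U₂ k))
         ≡ c₁ * sumFrom (suc n) (m ∸ n) (high-summand U₁) + c₂ * sumFrom (suc n) (m ∸ n) (high-summand U₂)
  high = trans (sum-ext (suc n) (m ∸ n) (λ k →
    solve 5 (λ w x y u₁ u₂ → w :* (x :* u₁ :+ y :* u₂) := x :* (w :* u₁) :+ y :* (w :* u₂)) refl
            (highCoeff m n k) c₁ c₂ (U₁ k) (U₂ k)))
    (combine (suc n) (m ∸ n) (high-summand U₁) (high-summand U₂))

Φ-sum : ∀ m n a l (F G : ℕ → ℕ → ℚ) →
        Φ m n (λ k → sumFrom a l (λ y → F y k)) (λ k → sumFrom a l (λ y → G y k)) ≡ sumFrom a l (λ y → Φ m n (F y) (G y))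
Φ-sum m n a l F G = trans (cong₂ _+_ low high) (sym (sum-+ a l _ _))
  where
  A B : ℕ → ℚ
  A k = ι (binomials₄ m n k)
  B k = 1ℚ + ι k * harmonicSum m n k
  low : sumFrom 0 (suc n) (λ k → A k * (B k * sumFrom a l (λ y → F y k) - ι k * sumFrom a l (λ y → G y k)))
        ≡ sumFrom a l (λ y → sumFrom 0 (suc n) (λ k → A k * (B k * F y k - ι k * G y k)))
  low = trans (sum-ext 0 (suc n) (λ k → begin
      A k * (B k * sumFrom a l (λ y → F y k) - ι k * sumFrom a l (λ y → G y k))
        ≡⟨ cong (A k *_) (cong₂ _-_ (sym (sum-*ˡ a l (B k) (λ y → F y k))) (sym (sum-*ˡ a l (ι k) (λ y → G y k)))) ⟩
      A k * (sumFrom a l (λ y → B k * F y k) - sumFrom a l (λ y → ι k * G y k))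
        ≡⟨ cong (A k *_) (sym (sum-- a l (λ y → B k * F y k) (λ y → ι k * G y k))) ⟩
      A k * sumFrom a l (λ y → B k * F y k - ι k * G y k)
        ≡⟨ sym (sum-*ˡ a l (A k) (λ y → B k * F y k - ι k * G y k)) ⟩
      sumFrom a l (λ y → A k * (B k * F y k - ι k * G y k))
        ∎))
    (sum-swap 0 (suc n) a l (λ k y → A k * (B k * F y k - ι k * G y k)))
  high : sumFrom (suc n) (m ∸ n) (λ k → highCoeff m n k * sumFrom a l (λ y → F y k))
         ≡ sumFrom a l (λ y → sumFrom (suc n) (m ∸ n) (λ k → highCoeff m n k * F y k))
  high = trans (sum-ext (suc n) (m ∸ n) (λ k → sym (sum-*ˡ a l (highCoeff m n k) (λ y → F y k))))
    (sum-swap (suc n) (m ∸ n) a l (λ k y → highCoeff m n k * F y k))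

harmonicGap : ℕ → ℕ → ℕ → ℕ → ℚ
harmonicGap i N r k = H i (k +ℕ N) - H i (k +ℕ r)

harmonicGap≡sum : ∀ i r l k → harmonicGap i (r +ℕ l) r k ≡ sumFrom 1 l (λ y → inv (ι (k +ℕ (r +ℕ y))) ^ℚ i)
harmonicGap≡sum i r l k = begin
  H i (k +ℕ (r +ℕ l)) - H i (k +ℕ r)
    ≡⟨ cong (λ z → H i z - H i (k +ℕ r)) (sym (ℕ.+-assoc k r l)) ⟩
  H i (k +ℕ r +ℕ l) - H i (k +ℕ r)
    ≡⟨ cong (_- H i (k +ℕ r)) (H-+ i (k +ℕ r) l) ⟩
  H i (k +ℕ r) + sumFrom 1 l (λ y → inv (ι (k +ℕ r +ℕ y)) ^ℚ i) - H i (k +ℕ r)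
    ≡⟨ solve 2 (λ h s → h :+ s :- h := s) refl (H i (k +ℕ r)) _ ⟩
  sumFrom 1 l (λ y → inv (ι (k +ℕ r +ℕ y)) ^ℚ i)
    ≡⟨ sum-ext 1 l (λ y → cong (λ z → inv (ι z) ^ℚ i) (ℕ.+-assoc k r y)) ⟩
  sumFrom 1 l (λ y → inv (ι (k +ℕ (r +ℕ y))) ^ℚ i)
    ∎

Φ-harmonicGap≡0 : ∀ {m n r N} → n ≤ m → r ≤ N → N ≤ m → Φ m n (harmonicGap 1 N r) (harmonicGap 2 N r) ≡ 0ℚ
Φ-harmonicGap≡0 {m} {n} {r} {N} n≤m r≤N N≤m = begin
  Φ m n (harmonicGap 1 N r) (harmonicGap 2 N r)
    ≡⟨ subst (λ M → Φ m n (harmonicGap 1 N r) (harmonicGap 2 N r) ≡ Φ m n (harmonicGap 1 M r) (harmonicGap 2 M r))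
             (sym (ℕ.m+[n∸m]≡n r≤N)) refl ⟩
  Φ m n (harmonicGap 1 (r +ℕ l) r) (harmonicGap 2 (r +ℕ l) r)
    ≡⟨ Φ-cong m n (harmonicGap≡sum 1 r l) (harmonicGap≡sum 2 r l) ⟩
  Φ m n (λ k → sumFrom 1 l (λ y → inv (ι (k +ℕ (r +ℕ y))) ^ℚ 1)) (λ k → sumFrom 1 l (λ y → inv (ι (k +ℕ (r +ℕ y))) ^ℚ 2))
    ≡⟨ Φ-sum m n 1 l (λ y k → inv (ι (k +ℕ (r +ℕ y))) ^ℚ 1) (λ y k → inv (ι (k +ℕ (r +ℕ y))) ^ℚ 2) ⟩
  sumFrom 1 l (λ y → Φ m n (λ k → inv (ι (k +ℕ (r +ℕ y))) ^ℚ 1) (λ k → inv (ι (k +ℕ (r +ℕ y))) ^ℚ 2))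
    ≡⟨ sum-zero 1 l basis≡0 ⟩
  0ℚ
    ∎
  where
  l = N ∸ r
  basis≡0 : ∀ y → 1 ≤ y → y < 1 +ℕ l → Φ m n (λ k → inv (ι (k +ℕ (r +ℕ y))) ^ℚ 1) (λ k → inv (ι (k +ℕ (r +ℕ y))) ^ℚ 2) ≡ 0ℚ
  basis≡0 (suc y) _ (s≤s y<l) =
    subst (λ z → Φ m n (λ k → inv (ι (k +ℕ z)) ^ℚ 1) (λ k → inv (ι (k +ℕ z)) ^ℚ 2) ≡ 0ℚ) (sym (ℕ.+-suc r y))
          (Φ-basis≡0 n≤m (r +ℕ y) (subst (_≤ m) (ℕ.+-suc r y) (ℕ.≤-trans (ℕ.+-monoʳ-≤ r y<l) r+l≤m)))
    where
    r+l≤m : r +ℕ l ≤ m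
    r+l≤m = subst (_≤ m) (sym (ℕ.m+[n∸m]≡n r≤N)) N≤m

k+p∸q∸1≡k+[p∸q∸1] : ∀ k {p q} → q < p → k +ℕ p ∸ q ∸ 1 ≡ k +ℕ (p ∸ q ∸ 1)
k+p∸q∸1≡k+[p∸q∸1] k {p} {q} q<p = trans (cong (_∸ 1) (ℕ.+-∸-assoc k (ℕ.<⇒≤ q<p))) (ℕ.+-∸-assoc k (ℕ.m<n⇒0<n∸m q<p))

p∸q∸1≤q : ∀ {p q} → p ≤ 2 *ℕ q → p ∸ q ∸ 1 ≤ q
p∸q∸1≤q {p} {q} p≤2q = ℕ.≤-trans (ℕ.m∸n≤m (p ∸ q) 1) (ℕ.m≤n+o⇒m∸n≤o p q (subst (p ≤_) (cong (q +ℕ_) (ℕ.+-identityʳ q)) p≤2q))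

-- The hypothesis 1 ≤ n is unused: it already follows from n ≤ m < p ≤ 2n.
corollary3p4 : (p m n : ℕ) → 1 ≤ n → n ≤ m → m < p → p ≤ 2 *ℕ n → (C₁ C₂ : ℚ) →
    RHS p m n C₁ C₂ ≡ 0ℚ
corollary3p4 p m n _ n≤m m<p p≤2n C₁ C₂ = begin
  RHS p m n C₁ C₂
    ≡⟨ Φ-cong m n (λ k → cong₂ (λ x y → C₁ * (H 1 (k +ℕ n) - H 1 x) + C₂ * (H 1 (k +ℕ m) - H 1 y)) (shift k n<p) (shift k m<p))
                  (λ k → cong₂ (λ x y → C₁ * (H 2 (k +ℕ n) - H 2 x) + C₂ * (H 2 (k +ℕ m) - H 2 y)) (shift k n<p) (shift k m<p)) ⟩
  Φ m n (λ k → C₁ * harmonicGap 1 n r₁ k + C₂ * harmonicGap 1 m r₂ k) (λ k → C₁ * harmonicGap 2 n r₁ k + C₂ * harmonicGap 2 m r₂ k)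
    ≡⟨ Φ-linear m n C₁ C₂ (harmonicGap 1 n r₁) (harmonicGap 1 m r₂) (harmonicGap 2 n r₁) (harmonicGap 2 m r₂) ⟩
  C₁ * Φ m n (harmonicGap 1 n r₁) (harmonicGap 2 n r₁) + C₂ * Φ m n (harmonicGap 1 m r₂) (harmonicGap 2 m r₂)
    ≡⟨ cong₂ (λ x y → C₁ * x + C₂ * y) (Φ-harmonicGap≡0 n≤m (p∸q∸1≤q p≤2n) n≤m)
                                        (Φ-harmonicGap≡0 n≤m (p∸q∸1≤q (ℕ.≤-trans p≤2n (ℕ.*-monoʳ-≤ 2 n≤m))) ℕ.≤-refl) ⟩
  C₁ * 0ℚ + C₂ * 0ℚ
    ≡⟨ cong₂ _+_ (*-zeroʳ C₁) (*-zeroʳ C₂) ⟩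
  0ℚ
    ∎
  where
  r₁ = p ∸ n ∸ 1
  r₂ = p ∸ m ∸ 1
  n<p = ℕ.≤-<-trans n≤m m<p
  shift = k+p∸q∸1≡k+[p∸q∸1]
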